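{- Let $n\ge 1$ and $d\ge 0$ be integers. Let $\mathsf{C}_{n,d}$ be the set of compositions of $d$ with at most $n$ parts, and let $\mathsf{PB}_{n,d}$ be the set of pairs $(\lambda,\beta)$ where $\lambda$ is a partition with at most $n$ parts, $\beta\in\mathsf{B}_n$ (a pure and inverting composition with at most $n$ parts), and $|\lambda|+|\beta|=d$. Then the map $\phi\colon \mathsf{PB}_{n,d}\to\mathsf{C}_{n,d}$ defined below is a bijection.
   Context: A composition is a finite sequence $\alpha=(\alpha_1,\dots,\alpha_k)$ of positive integers; $\ell(\alpha)=k$ is its length and $|\alpha|=\sum_i\alpha_i$. The empty composition (length $0$, written $0$) is allowed. A composition $\alpha$ is inverting if for every integer $i$ with $1<i\le\max_j\alpha_j$ there exist indices $s<t$ with $\alpha_s=i$ and $\alpha_t=i-1$. Every composition admits a unique factorization $\alpha=\gamma\, k^{i_k}\cdots 2^{i_2}1^{i_1}$ (concatenation of words, $i_j\ge1$) in which $\gamma$ is a composition containing none of the values $1,\dots,k$ and $k\ge 0$ is maximal; $\alpha$ is pure if this maximal $k$ is even. (E.g. $5435211$ is pure with $k=2$, $3231$ is impure with $k=1$; a composition whose last part is not $1$ has $k=0$ and is pure.) $\mathsf{B}_n$ denotes the set of pure and inverting compositions with at most $n$ parts, including the empty composition. The map $\phi$: given $(\lambda,\beta)\in\mathsf{PB}_{n,d}$ with $\lambda=(\lambda_1\ge\lambda_2\ge\cdots\ge\lambda_L>0)$, if $L>\ell(\beta)$ first append $L-\ell(\beta)$ zeros after the last part of $\beta$. Order the parts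 of (the padded) $\beta$ by size, where if $\beta_j=\beta_k$ with $j<k$ then $\beta_j$ is considered smaller than $\beta_k$. Then $\phi(\lambda,\beta)$ is the composition obtained by adding $\lambda_i$ to the $i$-th largest part of $\beta$ for each $1\le i\le L$. (Example: $\lambda=54442211111$, $\beta=243113423$ gives $\phi(\lambda,\beta)=38522794711$.) -}

module Defs where

open import Data.Nat using (ℕ; zero; suc; _+_; _∸_; _≤_; _<_; _⊔_; pred; _<ᵇ_; _≡ᵇ_)
open import Data.Nat.Properties using ()
open import Data.Bool using (Bool; _∨_; _∧_)
open import Data.Nat.ListAction using (sum)
open import Data.List using (List; []; _∷_; _++_; length; replicate; zip; upTo; map; filterᵇ; lookup; foldr)
open import Data.List.Relation.Unary.All using (All)
open import Data.Fin as Fin using (Fin)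
open import Data.Product using (Σ; ∃; ∃-syntax; _×_; _,_)
open import Relation.Binary.PropositionalEquality using (_≡_)

IsComposition : List ℕ → Set
IsComposition α = All (λ x → 0 < x) α

data Decreasing : List ℕ → Set where
  dec[]  : Decreasing []
  dec[_] : ∀ x → Decreasing (x ∷ [])
  dec∷   : ∀ {x y xs} → y ≤ x → Decreasing (y ∷ xs) → Decreasing (x ∷ y ∷ xs)

IsPartition : List ℕ → Set
IsPartition λ' = IsComposition λ' × Decreasing λ'

maxPart : List ℕ → ℕ
maxPart = foldr _⊔_ 0

Inverting : List ℕ → Set
Inverting α = ∀ i → 1 < i → i ≤ maxPart α →
  ∃[ s ] ∃[ t ] (s Fin.< t × lookup α s ≡ i × lookup α t ≡ pred i)

-- stair [i_k, ..., i_1] = k^{i_k} ... 2^{i_2} 1^{i_1}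
stair : List ℕ → List ℕ
stair []       = []
stair (m ∷ ms) = replicate m (suc (length ms)) ++ stair ms

HasTail : List ℕ → ℕ → Set
HasTail α k = ∃[ γ ] ∃[ ms ]
  (length ms ≡ k × All (λ m → 0 < m) ms × All (λ x → k < x) γ × α ≡ γ ++ stair ms)

data Even : ℕ → Set where
  even-zero : Even 0
  even-ss   : ∀ {n} → Even n → Even (suc (suc n))

Pure : List ℕ → Set
Pure α = ∃[ k ] (HasTail α k × (∀ k' → HasTail α k' → k' ≤ k) × Even k)

InB : ℕ → List ℕ → Set
InB n β = IsComposition β × Pure β × Inverting β × length β ≤ n

InC : ℕ → ℕ → List ℕ → Set
InC n d α = IsComposition α × sum α ≡ d × length α ≤ n

InPB : ℕ → ℕ → List ℕ → List ℕ → Set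
InPB n d λ' β = IsPartition λ' × length λ' ≤ n × InB n β × sum λ' + sum β ≡ d

nth : List ℕ → ℕ → ℕ
nth []       _       = 0
nth (x ∷ xs) zero    = x
nth (x ∷ xs) (suc i) = nth xs i

pad : ℕ → List ℕ → List ℕ
pad L β = β ++ replicate (L ∸ length β) 0

indexed : List ℕ → List (ℕ × ℕ)
indexed xs = zip (upTo (length xs)) xs

-- (k , b) is larger than (j , a) in the order of the paper:
-- by value, ties broken so that the later position is larger.
larger : ℕ × ℕ → ℕ × ℕ → Bool
larger (k , b) (j , a) = (a <ᵇ b) ∨ ((a ≡ᵇ b) ∧ (j <ᵇ k))

-- 0-based rank: number of parts larger than the given one
-- (the part of rank r is the (r+1)-th largest).
rank : List (ℕ × ℕ) → ℕ × ℕ → ℕ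
rank ps p = length (filterᵇ (λ q → larger q p) ps)

φ : List ℕ → List ℕ → List ℕ
φ λ' β = map (λ { (j , a) → a + nth λ' (rank ps (j , a)) }) ps
  where ps = indexed (pad (length λ') β)

module Submission where

-- φ adds λᵢ to the part of β of rank i. As λ is weakly decreasing this does not change
-- the rank order, so α = φ λ β and β rank their parts alike. In an inverting β,
-- parts adjacent in rank differ by 0 or 1 (by 1 exactly when the higher part comes first) and the
-- lowest part is 0 or 1; so the rank order fixes β up to adding one to every part, which flips
-- purity. Hence β, and then λ, are determined by α. Conversely, if α meets these adjacency
-- conditions it is inverting, and it is β or β shifted by one, with λ empty or a column of ones,
-- according to its purity; otherwise a violated condition lets us remove a column from its
-- top-ranked parts without changing the rank order, and we recurse on the smaller composition.

open import Data.Nat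
open import Data.Nat.Properties
open import Algebra.Properties.CommutativeSemigroup +-commutativeSemigroup using (interchange; xy∙z≈xz∙y)
open import Data.Nat.ListAction using (sum)
open import Data.Bool using (Bool; true; false; T)
open import Data.Bool.Properties using (T-≡)
open import Data.Empty using (⊥; ⊥-elim)
open import Data.Fin as Fin using (Fin; toℕ; fromℕ<)
open import Data.Fin.Properties using (toℕ<n; toℕ-fromℕ<)
open import Data.List
  using (List; []; _∷_; _++_; _∷ʳ_; length; replicate; map; applyUpTo; filterᵇ; zip; lookup; initLast; _∷ʳ′_)
open import Data.List.Properties
  using ( length-++; length-replicate; length-map; length-applyUpTo; map-applyUpTo; map-++; ++-assoc; map-replicate
        ; map-injective; ++-identityʳ; ∷-injective)
open import Data.List.Relation.Unary.All as All using (All; []; _∷_)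
open import Data.List.Relation.Unary.All.Properties using (++⁺; map⁺; replicate⁺; ∷ʳ⁻; applyUpTo⁺₁)
open import Data.Product using (∃-syntax; _×_; _,_; proj₁; proj₂)
open import Data.Sum using (_⊎_; inj₁; inj₂; [_,_]′)
open import Data.Unit using (tt)
open import Function using (_∘_; id)
open import Function.Bundles using (Equivalence)
open import Relation.Binary using (tri<; tri≈; tri>)
open import Relation.Binary.PropositionalEquality
open import Relation.Nullary using (¬_; Dec; yes; no)
open import Relation.Nullary.Decidable using (_→-dec_)
open import Relation.Nullary.Reflects using (Reflects; ofʸ; ofⁿ; det; fromEquivalence; _⊎-reflects_; _×-reflects_)
open import Relation.Unary using (Decidable)
open import Defs

sumBelow : (ℕ → ℕ) → ℕ → ℕ
sumBelow f zero    = 0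
sumBelow f (suc m) = f 0 + sumBelow (f ∘ suc) m

sumBelow-cong : ∀ f g m → (∀ i → i < m → f i ≡ g i) → sumBelow f m ≡ sumBelow g m
sumBelow-cong f g zero    f≗g = refl
sumBelow-cong f g (suc m) f≗g = cong₂ _+_ (f≗g 0 z<s) (sumBelow-cong _ _ m (λ i → f≗g (suc i) ∘ s<s))

sumBelow-mono-≤ : ∀ f g m → (∀ i → i < m → f i ≤ g i) → sumBelow f m ≤ sumBelow g m
sumBelow-mono-≤ f g zero    f≤g = z≤n
sumBelow-mono-≤ f g (suc m) f≤g = +-mono-≤ (f≤g 0 z<s) (sumBelow-mono-≤ _ _ m (λ i → f≤g (suc i) ∘ s<s))

sumBelow-mono-< : ∀ f g m → (∀ i → i < m → f i ≤ g i) →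
                  ∀ w → w < m → f w < g w → sumBelow f m < sumBelow g m
sumBelow-mono-< f g (suc m) f≤g zero    _         fw<gw =
  +-mono-<-≤ fw<gw (sumBelow-mono-≤ _ _ m (λ i → f≤g (suc i) ∘ s<s))
sumBelow-mono-< f g (suc m) f≤g (suc w) (s<s w<m) fw<gw =
  +-mono-≤-< (f≤g 0 z<s) (sumBelow-mono-< _ _ m (λ i → f≤g (suc i) ∘ s<s) w w<m fw<gw)

sumBelow-+ : ∀ f g m → sumBelow (λ i → f i + g i) m ≡ sumBelow f m + sumBelow g m
sumBelow-+ f g zero    = refl
sumBelow-+ f g (suc m) = trans (cong (f 0 + g 0 +_) (sumBelow-+ (f ∘ suc) (g ∘ suc) m))
                               (interchange (f 0) (g 0) _ _)

sumBelow-*ˡ : ∀ c f m → sumBelow (λ i → c * f i) m ≡ c * sumBelow f m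
sumBelow-*ˡ c f zero    = sym (*-zeroʳ c)
sumBelow-*ˡ c f (suc m) = trans (cong (c * f 0 +_) (sumBelow-*ˡ c (f ∘ suc) m)) (sym (*-distribˡ-+ c (f 0) _))

sumBelow-≡0 : ∀ f m → (∀ i → i < m → f i ≡ 0) → sumBelow f m ≡ 0
sumBelow-≡0 f zero    f≗0 = refl
sumBelow-≡0 f (suc m) f≗0 = cong₂ _+_ (f≗0 0 z<s) (sumBelow-≡0 _ m (λ i → f≗0 (suc i) ∘ s<s))

sumBelow-single : ∀ f m w → w < m → (∀ i → i < m → i ≢ w → f i ≡ 0) → sumBelow f m ≡ f w
sumBelow-single f (suc m) zero    _         others =
  trans (cong (f 0 +_) (sumBelow-≡0 _ m (λ i i<m → others (suc i) (s<s i<m) (λ ())))) (+-identityʳ (f 0))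
sumBelow-single f (suc m) (suc w) (s<s w<m) others =
  trans (cong (_+ sumBelow (f ∘ suc) m) (others 0 z<s (λ ())))
        (sumBelow-single _ m w w<m (λ i i<m i≢w → others (suc i) (s<s i<m) (i≢w ∘ suc-injective)))

sumBelow-comm : ∀ (F : ℕ → ℕ → ℕ) m n →
                sumBelow (λ i → sumBelow (F i) n) m ≡ sumBelow (λ j → sumBelow (λ i → F i j) m) n
sumBelow-comm F zero    n = sym (sumBelow-≡0 _ n (λ _ _ → refl))
sumBelow-comm F (suc m) n = trans (cong (sumBelow (F 0) n +_) (sumBelow-comm (F ∘ suc) m n))
                                  (sym (sumBelow-+ (F 0) _ n))

fromBool : Bool → ℕ
fromBool true  = 1
fromBool false = 0

count : (ℕ → Bool) → ℕ → ℕ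
count P = sumBelow (fromBool ∘ P)

count-cong : ∀ P Q m → (∀ i → i < m → P i ≡ Q i) → count P m ≡ count Q m
count-cong P Q m P≗Q = sumBelow-cong _ _ m (λ i i<m → cong fromBool (P≗Q i i<m))

count-all : ∀ m → count (λ _ → true) m ≡ m
count-all zero    = refl
count-all (suc m) = cong suc (count-all m)

count-≡0 : ∀ P m → (∀ i → i < m → ¬ T (P i)) → count P m ≡ 0
count-≡0 P m none = sumBelow-≡0 _ m vanishes
  where
  vanishes : ∀ i → i < m → fromBool (P i) ≡ 0
  vanishes i i<m with P i | none i i<m
  ... | false | _  = refl
  ... | true  | ¬t = ⊥-elim (¬t _)

count-≤1 : ∀ P m → (∀ a b → a < m → b < m → T (P a) → T (P b) → a ≡ b) → count P m ≤ 1
count-≤1 P zero    unique = z≤n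
count-≤1 P (suc m) unique with P 0 in P0
... | true  = ≤-reflexive (cong suc (count-≡0 _ m (λ i i<m Pi → 0≢1+n (unique 0 (suc i) z<s (s<s i<m) (subst T (sym P0) _) Pi))))
... | false = count-≤1 _ m (λ a b a<m b<m Pa Pb → suc-injective (unique (suc a) (suc b) (s<s a<m) (s<s b<m) Pa Pb))

count>0⇒∃ : ∀ P m → 0 < count P m → ∃[ i ] (i < m × T (P i))
count>0⇒∃ P (suc m) pos with P 0 in P0
... | true  = 0 , z<s , subst T (sym P0) _
... | false with count>0⇒∃ _ m pos
...   | i , i<m , Pi = suc i , s<s i<m , Pi

fromBool-mono : ∀ {b c} → (T b → T c) → fromBool b ≤ fromBool c
fromBool-mono {false}         _   = z≤n
fromBool-mono {true} {true}   _   = ≤-refl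
fromBool-mono {true} {false} b⇒c = ⊥-elim (b⇒c _)

count-mono-< : ∀ P Q m → (∀ i → i < m → T (P i) → T (Q i)) →
               ∀ w → w < m → ¬ T (P w) → T (Q w) → count P m < count Q m
count-mono-< P Q m P⇒Q w w<m ¬Pw Qw =
  sumBelow-mono-< _ _ m (λ i i<m → fromBool-mono (P⇒Q i i<m)) w w<m (strict (P w) (Q w) ¬Pw Qw)
  where
  strict : ∀ b c → ¬ T b → T c → fromBool b < fromBool c
  strict false true _  _ = z<s
  strict true  _    ¬b _ = ⊥-elim (¬b _)

module _ {P : ℕ → Set} (P? : Decidable P) where

  all-or-counterexample : ∀ m → (∀ i → i < m → P i) ⊎ ∃[ i ] (i < m × ¬ P i)
  all-or-counterexample zero = inj₁ λ _ ()
  all-or-counterexample (suc m) with all-or-counterexample m | P? m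
  ... | inj₂ (i , i<m , ¬Pi) | _      = inj₂ (i , m<n⇒m<1+n i<m , ¬Pi)
  ... | inj₁ _               | no ¬Pm = inj₂ (m , ≤-refl , ¬Pm)
  ... | inj₁ all             | yes Pm = inj₁ λ i i<1+m → [ all i , (λ { refl → Pm }) ]′ (m<1+n⇒m<n∨m≡n i<1+m)

  all<? : ∀ m → Dec (∀ i → i < m → P i)
  all<? m with all-or-counterexample m
  ... | inj₁ all                = yes all
  ... | inj₂ (i , i<m , ¬Pi)    = no λ all → ¬Pi (all i i<m)

counterexample-→ : ∀ {A B : Set} → Dec A → Dec B → ¬ (A → B) → A × ¬ B
counterexample-→ _       (yes b) ¬a→b = ⊥-elim (¬a→b λ _ → b)
counterexample-→ (no ¬a) (no _)  ¬a→b = ⊥-elim (¬a→b λ a → ⊥-elim (¬a a))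
counterexample-→ (yes a) (no ¬b) _    = a , ¬b

argmax< : ∀ {P : ℕ → Set} → Decidable P → (r : ℕ → ℕ) → ∀ m → ∃[ p ] (p < m × P p) →
          ∃[ j ] (j < m × P j × (∀ q → q < m → P q → r q ≤ r j))
argmax< {P} P? r (suc m) (p , p<1+m , Pp) with anyUpTo? P? m
... | no ¬below = m , ≤-refl , subst P (≡m p<1+m Pp) Pp , λ q q<1+m Pq → ≤-reflexive (cong r (≡m q<1+m Pq))
  where
  ≡m : ∀ {q} → q < suc m → P q → q ≡ m
  ≡m q<1+m Pq with m<1+n⇒m<n∨m≡n q<1+m
  ... | inj₁ q<m = ⊥-elim (¬below (_ , q<m , Pq))
  ... | inj₂ q≡m = q≡m
... | yes below with argmax< P? r m below | P? m
...   | j , j<m , Pj , max | no ¬Pm = j , m<n⇒m<1+n j<m , Pj , λ q q<1+m Pq →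
  [ (λ q<m → max q q<m Pq) , (λ { refl → ⊥-elim (¬Pm Pq) }) ]′ (m<1+n⇒m<n∨m≡n q<1+m)
...   | j , j<m , Pj , max | yes Pm with r m ≤? r j
...     | yes rm≤rj = j , m<n⇒m<1+n j<m , Pj , λ q q<1+m Pq →
  [ (λ q<m → max q q<m Pq) , (λ { refl → rm≤rj }) ]′ (m<1+n⇒m<n∨m≡n q<1+m)
...     | no  rm≰rj = m , ≤-refl , Pm , λ q q<1+m Pq →
  [ (λ q<m → ≤-trans (max q q<m Pq) (<⇒≤ (≰⇒> rm≰rj))) , (λ { refl → ≤-refl }) ]′ (m<1+n⇒m<n∨m≡n q<1+m)

-- Ranking positions

reflects-sound : ∀ {A : Set} {b} → Reflects A b → T b → A
reflects-sound (ofʸ a) _ = a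

reflects-complete : ∀ {A : Set} {b} → Reflects A b → A → T b
reflects-complete (ofʸ _)  _ = tt
reflects-complete (ofⁿ ¬a) a = ¬a a

Above : (ℕ → ℕ) → ℕ → ℕ → Set
Above f k j = f j < f k ⊎ (f j ≡ f k × j < k)

above? : (ℕ → ℕ) → ℕ → ℕ → Bool
above? f k j = larger (k , f k) (j , f j)

rankAt : (ℕ → ℕ) → ℕ → ℕ → ℕ
rankAt f m j = count (λ k → above? f k j) m

module _ (f : ℕ → ℕ) where

  above?-reflects : ∀ k j → Reflects (Above f k j) (above? f k j)
  above?-reflects k j =
    <ᵇ-reflects-< (f j) (f k)
      ⊎-reflects (fromEquivalence (≡ᵇ⇒≡ (f j) (f k)) (≡⇒≡ᵇ (f j) (f k)) ×-reflects <ᵇ-reflects-< j k)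

  above?-sound : ∀ {k j} → T (above? f k j) → Above f k j
  above?-sound {k} {j} = reflects-sound (above?-reflects k j)

  above?-complete : ∀ {k j} → Above f k j → T (above? f k j)
  above?-complete {k} {j} = reflects-complete (above?-reflects k j)

  Above-irrefl : ∀ j → ¬ Above f j j
  Above-irrefl j (inj₁ fj<fj)      = <-irrefl refl fj<fj
  Above-irrefl j (inj₂ (_ , j<j)) = <-irrefl refl j<j

  Above-trans : ∀ a b c → Above f a b → Above f b c → Above f a c
  Above-trans a b c (inj₁ x)       (inj₁ y)        = inj₁ (<-trans y x)
  Above-trans a b c (inj₁ x)       (inj₂ (e , _))  = inj₁ (subst (_< f a) (sym e) x)
  Above-trans a b c (inj₂ (e , _)) (inj₁ y)        = inj₁ (subst (f c <_) e y)
  Above-trans a b c (inj₂ (e , x)) (inj₂ (e' , y)) = inj₂ (trans e' e , <-trans y x)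

  Above-asym : ∀ a b → Above f a b → ¬ Above f b a
  Above-asym a b x y = Above-irrefl a (Above-trans a b a x y)

  Above-total : ∀ a b → a ≢ b → Above f a b ⊎ Above f b a
  Above-total a b a≢b with <-cmp (f a) (f b) | <-cmp a b
  ... | tri< fa<fb _ _ | _              = inj₂ (inj₁ fa<fb)
  ... | tri> _ _ fa>fb | _              = inj₁ (inj₁ fa>fb)
  ... | tri≈ _ fa≡fb _ | tri< a<b _ _   = inj₂ (inj₂ (fa≡fb , a<b))
  ... | tri≈ _ _ _     | tri≈ _ a≡b _   = ⊥-elim (a≢b a≡b)
  ... | tri≈ _ fa≡fb _ | tri> _ _ a>b   = inj₁ (inj₂ (sym fa≡fb , a>b))

  rankAt<m : ∀ m j → j < m → rankAt f m j < m
  rankAt<m m j j<m = subst (rankAt f m j <_) (count-all m)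
    (count-mono-< _ _ m (λ _ _ _ → tt) j j<m (Above-irrefl j ∘ above?-sound) tt)

  Above⇒rankAt-< : ∀ m p j → p < m → Above f p j → rankAt f m p < rankAt f m j
  Above⇒rankAt-< m p j p<m p>j = count-mono-< _ _ m
    (λ k _ k>p → above?-complete (Above-trans k p j (above?-sound k>p) p>j))
    p p<m (Above-irrefl p ∘ above?-sound) (above?-complete p>j)

  rankAt-injective : ∀ m p j → p < m → j < m → rankAt f m p ≡ rankAt f m j → p ≡ j
  rankAt-injective m p j p<m j<m eq with p ≟ j
  ... | yes p≡j = p≡j
  ... | no  p≢j with Above-total p j p≢j
  ...   | inj₁ p>j = ⊥-elim (<-irrefl eq (Above⇒rankAt-< m p j p<m p>j))
  ...   | inj₂ j>p = ⊥-elim (<-irrefl (sym eq) (Above⇒rankAt-< m j p j<m j>p))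

  rankAt-<⇒Above : ∀ m p j → p < m → j < m → rankAt f m p < rankAt f m j → Above f p j
  rankAt-<⇒Above m p j p<m j<m lt with p ≟ j
  ... | yes refl = ⊥-elim (<-irrefl refl lt)
  ... | no  p≢j with Above-total p j p≢j
  ...   | inj₁ p>j = p>j
  ...   | inj₂ j>p = ⊥-elim (<-asym lt (Above⇒rankAt-< m j p j<m j>p))

  rankAt-≤⇒parts-≥ : ∀ m {a b} → a < m → b < m → rankAt f m a ≤ rankAt f m b → f b ≤ f a × (f b ≡ f a → b ≤ a)
  rankAt-≤⇒parts-≥ m {a} {b} a<m b<m ra≤rb with a ≟ b
  ... | yes refl = ≤-refl , λ _ → ≤-refl
  ... | no  a≢b with rankAt-<⇒Above m a b a<m b<m (≤∧≢⇒< ra≤rb (a≢b ∘ rankAt-injective m a b a<m b<m))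
  ...   | inj₁ fb<fa         = <⇒≤ fb<fa , λ fb≡fa → ⊥-elim (<-irrefl fb≡fa fb<fa)
  ...   | inj₂ (fb≡fa , b<a) = ≤-reflexive fb≡fa , λ _ → <⇒≤ b<a

  private
    #rank< : ℕ → ℕ → ℕ
    #rank< m h = count (λ j → rankAt f m j <ᵇ h) m

    #rank≡ : ℕ → ℕ → ℕ
    #rank≡ m h = count (λ j → rankAt f m j ≡ᵇ h) m

    #rank≡≤1 : ∀ m h → #rank≡ m h ≤ 1
    #rank≡≤1 m h = count-≤1 _ m (λ a b a<m b<m ra rb →
      rankAt-injective m a b a<m b<m (trans (≡ᵇ⇒≡ _ h ra) (sym (≡ᵇ⇒≡ _ h rb))))

    #rank<-suc : ∀ m h → #rank< m (suc h) ≡ #rank≡ m h + #rank< m h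
    #rank<-suc m h = trans (sumBelow-cong _ _ m (λ j _ → split (rankAt f m j) h))
                           (sumBelow-+ _ _ m)
      where
      split : ∀ a h → fromBool (a <ᵇ suc h) ≡ fromBool (a ≡ᵇ h) + fromBool (a <ᵇ h)
      split zero    zero    = refl
      split zero    (suc h) = refl
      split (suc a) zero    = refl
      split (suc a) (suc h) = split a h

    #rank<-+ : ∀ m h k → #rank< m (h + k) ≤ k + #rank< m h
    #rank<-+ m h zero    = ≤-reflexive (cong (#rank< m) (+-identityʳ h))
    #rank<-+ m h (suc k) = begin
      #rank< m (h + suc k)                ≡⟨ cong (#rank< m) (+-suc h k) ⟩
      #rank< m (suc (h + k))              ≡⟨ #rank<-suc m (h + k) ⟩
      #rank≡ m (h + k) + #rank< m (h + k) ≤⟨ +-mono-≤ (#rank≡≤1 m (h + k)) (#rank<-+ m h k) ⟩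
      suc k + #rank< m h                  ∎
      where open ≤-Reasoning

    #rank<-all : ∀ m → #rank< m m ≡ m
    #rank<-all m = trans (count-cong _ _ m (λ j j<m → Equivalence.to T-≡ (<⇒<ᵇ (rankAt<m m j j<m)))) (count-all m)

    #rank<≤ : ∀ m h → #rank< m h ≤ h
    #rank<≤ m zero    = ≤-reflexive (count-≡0 _ m (λ _ _ ()))
    #rank<≤ m (suc h) = subst (_≤ suc h) (sym (#rank<-suc m h)) (+-mono-≤ (#rank≡≤1 m h) (#rank<≤ m h))

    -- #rank< m grows by at most one per step and reaches m at m, so it is the identity below m.
    #rank<-exact : ∀ m h → h ≤ m → #rank< m h ≡ h
    #rank<-exact m h h≤m = ≤-antisym (#rank<≤ m h) (+-cancelˡ-≤ (m ∸ h) h (#rank< m h) (begin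
      m ∸ h + h              ≡⟨ m∸n+n≡m h≤m ⟩
      m                      ≡⟨ sym (#rank<-all m) ⟩
      #rank< m m             ≡⟨ cong (#rank< m) (sym (m+[n∸m]≡n h≤m)) ⟩
      #rank< m (h + (m ∸ h)) ≤⟨ #rank<-+ m h (m ∸ h) ⟩
      m ∸ h + #rank< m h     ∎))
      where open ≤-Reasoning

    #rank≡-≡1 : ∀ m h → h < m → #rank≡ m h ≡ 1
    #rank≡-≡1 m h h<m = +-cancelʳ-≡ h _ 1 (begin
      #rank≡ m h + h           ≡⟨ cong (#rank≡ m h +_) (sym (#rank<-exact m h (<⇒≤ h<m))) ⟩
      #rank≡ m h + #rank< m h  ≡⟨ sym (#rank<-suc m h) ⟩
      #rank< m (suc h)         ≡⟨ #rank<-exact m (suc h) h<m ⟩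
      suc h                    ∎)
      where open ≡-Reasoning

  rankAt-surjective : ∀ m r → r < m → ∃[ j ] (j < m × rankAt f m j ≡ r)
  rankAt-surjective m r r<m with count>0⇒∃ _ m (subst (0 <_) (sym (#rank≡-≡1 m r r<m)) z<s)
  ... | j , j<m , rj≡r = j , j<m , ≡ᵇ⇒≡ _ r rj≡r

  sumBelow-rankAt : ∀ m g → sumBelow (g ∘ rankAt f m) m ≡ sumBelow g m
  sumBelow-rankAt m g = begin
    sumBelow (g ∘ rankAt f m) m
      ≡⟨ sumBelow-cong _ _ m (λ j j<m → sym (spread j j<m)) ⟩
    sumBelow (λ j → sumBelow (δ j) m) m
      ≡⟨ sumBelow-comm δ m m ⟩
    sumBelow (λ r → sumBelow (λ j → δ j r) m) m
      ≡⟨ sumBelow-cong _ _ m gather ⟩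
    sumBelow g m ∎
    where
    open ≡-Reasoning
    δ : ℕ → ℕ → ℕ
    δ j r = fromBool (rankAt f m j ≡ᵇ r) * g r

    spread : ∀ j → j < m → sumBelow (δ j) m ≡ g (rankAt f m j)
    spread j j<m = trans (sumBelow-single _ m r (rankAt<m m j j<m) off)
                         (trans (cong (λ b → fromBool b * g r) (Equivalence.to T-≡ (≡⇒≡ᵇ r r refl))) (+-identityʳ (g r)))
      where
      r = rankAt f m j
      off : ∀ r′ → r′ < m → r′ ≢ r → δ j r′ ≡ 0
      off r′ _ r′≢r with r ≡ᵇ r′ in e
      ... | false = refl
      ... | true  = ⊥-elim (r′≢r (sym (≡ᵇ⇒≡ r r′ (Equivalence.from T-≡ e))))

    gather : ∀ r → r < m → sumBelow (λ j → δ j r) m ≡ g r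
    gather r r<m = begin
      sumBelow (λ j → δ j r) m
        ≡⟨ sumBelow-cong _ _ m (λ j _ → *-comm (fromBool (rankAt f m j ≡ᵇ r)) (g r)) ⟩
      sumBelow (λ j → g r * fromBool (rankAt f m j ≡ᵇ r)) m
        ≡⟨ sumBelow-*ˡ (g r) _ m ⟩
      g r * #rank≡ m r
        ≡⟨ cong (g r *_) (#rank≡-≡1 m r r<m) ⟩
      g r * 1
        ≡⟨ *-identityʳ (g r) ⟩
      g r ∎

rankAt-preserved : ∀ f g m → (∀ k j → k < m → j < m → Above f k j → Above g k j) →
                   ∀ j → j < m → rankAt g m j ≡ rankAt f m j
rankAt-preserved f g m preserve j j<m = count-cong _ _ m (λ k k<m →
  det (above?-reflects g k j) (fromEquivalence (preserve k j k<m j<m ∘ above?-sound f) (above?-complete f ∘ reflect k k<m)))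
  where
  reflect : ∀ k → k < m → Above g k j → Above f k j
  reflect k k<m k>j with k ≟ j
  ... | yes refl = ⊥-elim (Above-irrefl g k k>j)
  ... | no  k≢j with Above-total f k j k≢j
  ...   | inj₁ k>ᶠj = k>ᶠj
  ...   | inj₂ j>ᶠk = ⊥-elim (Above-asym g k j k>j (preserve j k j<m k<m j>ᶠk))

rankAt-cong : ∀ f g m → (∀ i → i < m → f i ≡ g i) → ∀ j → j < m → rankAt f m j ≡ rankAt g m j
rankAt-cong f g m f≗g j j<m =
  count-cong _ _ m (λ k k<m → cong₂ (λ a b → larger (k , a) (j , b)) (f≗g k k<m) (f≗g j j<m))

lowest-exists : ∀ f m → 0 < m → ∃[ b ] (b < m × suc (rankAt f m b) ≡ m)
lowest-exists f (suc m) _ with rankAt-surjective f (suc m) m ≤-refl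
... | b , b<m , rb≡m = b , b<m , cong suc rb≡m

nth-beyond : ∀ xs j → length xs ≤ j → nth xs j ≡ 0
nth-beyond []       j       _         = refl
nth-beyond (x ∷ xs) (suc j) (s≤s ℓ≤j) = nth-beyond xs j ℓ≤j

nth-positive : ∀ {xs} → All (0 <_) xs → ∀ j → j < length xs → 0 < nth xs j
nth-positive (x>0 ∷ _)   zero    _         = x>0
nth-positive (_ ∷ xs>0) (suc j) (s<s j<ℓ) = nth-positive xs>0 j j<ℓ

nth-applyUpTo : ∀ g m j → j < m → nth (applyUpTo g m) j ≡ g j
nth-applyUpTo g (suc m) zero    _         = refl
nth-applyUpTo g (suc m) (suc j) (s<s j<m) = nth-applyUpTo (g ∘ suc) m j j<m

applyUpTo-cong : ∀ {A : Set} (g h : ℕ → A) m → (∀ j → j < m → g j ≡ h j) → applyUpTo g m ≡ applyUpTo h m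
applyUpTo-cong g h zero    g≗h = refl
applyUpTo-cong g h (suc m) g≗h = cong₂ _∷_ (g≗h 0 z<s) (applyUpTo-cong _ _ m (λ j → g≗h (suc j) ∘ s<s))

applyUpTo-nth : ∀ xs → applyUpTo (nth xs) (length xs) ≡ xs
applyUpTo-nth []       = refl
applyUpTo-nth (x ∷ xs) = cong (x ∷_) (applyUpTo-nth xs)

nth-ext : ∀ xs ys → length xs ≡ length ys → (∀ j → j < length xs → nth xs j ≡ nth ys j) → xs ≡ ys
nth-ext xs ys ℓ≡ xs≗ys = begin
  xs                                  ≡⟨ sym (applyUpTo-nth xs) ⟩
  applyUpTo (nth xs) (length xs)      ≡⟨ applyUpTo-cong _ _ (length xs) xs≗ys ⟩
  applyUpTo (nth ys) (length xs)      ≡⟨ cong (applyUpTo (nth ys)) ℓ≡ ⟩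
  applyUpTo (nth ys) (length ys)      ≡⟨ applyUpTo-nth ys ⟩
  ys                                  ∎
  where open ≡-Reasoning

positive-nth-ext : ∀ {xs ys} → All (0 <_) xs → All (0 <_) ys → (∀ j → nth xs j ≡ nth ys j) → xs ≡ ys
positive-nth-ext []          []          _     = refl
positive-nth-ext []          (y>0 ∷ _)   xs≗ys = ⊥-elim (<-irrefl (xs≗ys 0) y>0)
positive-nth-ext (x>0 ∷ _)   []          xs≗ys = ⊥-elim (<-irrefl (sym (xs≗ys 0)) x>0)
positive-nth-ext (_ ∷ xs>0) (_ ∷ ys>0) xs≗ys = cong₂ _∷_ (xs≗ys 0) (positive-nth-ext xs>0 ys>0 (xs≗ys ∘ suc))

sum-sumBelow : ∀ xs m → length xs ≤ m → sum xs ≡ sumBelow (nth xs) m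
sum-sumBelow []       m       _        = sym (sumBelow-≡0 _ m (λ _ _ → refl))
sum-sumBelow (x ∷ xs) (suc m) (s≤s ℓ≤m) = cong (x +_) (sum-sumBelow xs m ℓ≤m)

sum-applyUpTo : ∀ g m → sum (applyUpTo g m) ≡ sumBelow g m
sum-applyUpTo g zero    = refl
sum-applyUpTo g (suc m) = cong (g 0 +_) (sum-applyUpTo (g ∘ suc) m)

nth-++ˡ : ∀ xs ys j → j < length xs → nth (xs ++ ys) j ≡ nth xs j
nth-++ˡ (x ∷ xs) ys zero    _         = refl
nth-++ˡ (x ∷ xs) ys (suc j) (s<s j<ℓ) = nth-++ˡ xs ys j j<ℓ

nth-++ʳ : ∀ xs ys j → length xs ≤ j → nth (xs ++ ys) j ≡ nth ys (j ∸ length xs)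
nth-++ʳ []       ys j       _         = refl
nth-++ʳ (x ∷ xs) ys (suc j) (s≤s ℓ≤j) = nth-++ʳ xs ys j ℓ≤j

nth-replicate : ∀ a x j → j < a → nth (replicate a x) j ≡ x
nth-replicate (suc a) x zero    _         = refl
nth-replicate (suc a) x (suc j) (s<s j<a) = nth-replicate a x j j<a

nth-replicate-0 : ∀ a j → nth (replicate a 0) j ≡ 0
nth-replicate-0 zero    j       = refl
nth-replicate-0 (suc a) zero    = refl
nth-replicate-0 (suc a) (suc j) = nth-replicate-0 a j

m+[n∸m]≡m⊔n : ∀ m n → m + (n ∸ m) ≡ m ⊔ n
m+[n∸m]≡m⊔n m n with ≤-total m n
... | inj₁ m≤n = trans (m+[n∸m]≡n m≤n) (sym (m≤n⇒m⊔n≡n m≤n))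
... | inj₂ n≤m = trans (cong (m +_) (m≤n⇒m∸n≡0 n≤m)) (trans (+-identityʳ m) (sym (m≥n⇒m⊔n≡m n≤m)))

nth-pad : ∀ L β j → nth (pad L β) j ≡ nth β j
nth-pad L β j with j <? length β
... | yes j<ℓ = nth-++ˡ β _ j j<ℓ
... | no  j≮ℓ = trans (nth-++ʳ β _ j (≮⇒≥ j≮ℓ))
                      (trans (nth-replicate-0 (L ∸ length β) _) (sym (nth-beyond β j (≮⇒≥ j≮ℓ))))

length-pad : ∀ L β → length (pad L β) ≡ length β ⊔ L
length-pad L β = trans (length-++ β) (trans (cong (length β +_) (length-replicate (L ∸ length β))) (m+[n∸m]≡m⊔n (length β) L))

zip-applyUpTo : ∀ {A : Set} (g : ℕ → A) xs → zip (applyUpTo g (length xs)) xs ≡ applyUpTo (λ i → (g i , nth xs i)) (length xs)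
zip-applyUpTo g []       = refl
zip-applyUpTo g (x ∷ xs) = cong ((g 0 , x) ∷_) (zip-applyUpTo (g ∘ suc) xs)

map-indexed : ∀ {B : Set} (F : ℕ × ℕ → B) xs → map F (indexed xs) ≡ applyUpTo (λ i → F (i , nth xs i)) (length xs)
map-indexed F xs = trans (cong (map F) (zip-applyUpTo id xs)) (map-applyUpTo _ F (length xs))

length-filterᵇ-applyUpTo : ∀ {A : Set} (P : A → Bool) g m → length (filterᵇ P (applyUpTo g m)) ≡ count (P ∘ g) m
length-filterᵇ-applyUpTo P g zero = refl
length-filterᵇ-applyUpTo P g (suc m) with P (g 0)
... | true  = cong suc (length-filterᵇ-applyUpTo P (g ∘ suc) m)
... | false = length-filterᵇ-applyUpTo P (g ∘ suc) m

rank-indexed : ∀ xs j → rank (indexed xs) (j , nth xs j) ≡ rankAt (nth xs) (length xs) j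
rank-indexed xs j = trans (cong (λ ps → rank ps (j , nth xs j)) (zip-applyUpTo id xs))
                          (length-filterᵇ-applyUpTo _ _ (length xs))

width : List ℕ → List ℕ → ℕ
width λ' β = length β ⊔ length λ'

φAt : (ℕ → ℕ) → (ℕ → ℕ) → ℕ → ℕ → ℕ
φAt ℓ f m j = f j + ℓ (rankAt f m j)

φ-applyUpTo : ∀ λ' β → φ λ' β ≡ applyUpTo (φAt (nth λ') (nth β) (width λ' β)) (width λ' β)
φ-applyUpTo λ' β = begin
  φ λ' β
    ≡⟨ map-indexed _ p ⟩
  applyUpTo (λ j → nth p j + nth λ' (rank (indexed p) (j , nth p j))) (length p)
    ≡⟨ applyUpTo-cong _ _ (length p) (λ j _ → cong (λ r → nth p j + nth λ' r) (rank-indexed p j)) ⟩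
  applyUpTo (φAt (nth λ') (nth p) (length p)) (length p)
    ≡⟨ cong (λ w → applyUpTo (φAt (nth λ') (nth p) w) w) (length-pad (length λ') β) ⟩
  applyUpTo (φAt (nth λ') (nth p) (width λ' β)) (width λ' β)
    ≡⟨ applyUpTo-cong _ _ (width λ' β) (λ j j<w →
         cong₂ (λ a r → a + nth λ' r) (nth-pad (length λ') β j)
               (rankAt-cong _ _ _ (λ i _ → nth-pad (length λ') β i) j j<w)) ⟩
  applyUpTo (φAt (nth λ') (nth β) (width λ' β)) (width λ' β) ∎
  where
  open ≡-Reasoning
  p = pad (length λ') β

applyUpTo-injective : ∀ g h m n → applyUpTo g m ≡ applyUpTo h n → m ≡ n × (∀ j → j < m → g j ≡ h j)
applyUpTo-injective g h m n eq = m≡n , λ j j<m →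
  trans (sym (nth-applyUpTo g m j j<m)) (trans (cong (λ xs → nth xs j) eq) (nth-applyUpTo h n j (subst (j <_) m≡n j<m)))
  where
  m≡n : m ≡ n
  m≡n = trans (sym (length-applyUpTo g m)) (trans (cong length eq) (length-applyUpTo h n))

φ-≡-applyUpTo : ∀ λ' β g m → φ λ' β ≡ applyUpTo g m →
                width λ' β ≡ m × (∀ p → p < m → φAt (nth λ') (nth β) m p ≡ g p)
φ-≡-applyUpTo λ' β g m φ≡ with applyUpTo-injective _ g _ m (trans (sym (φ-applyUpTo λ' β)) φ≡)
... | w≡m , parts = w≡m , subst (λ w → ∀ p → p < m → φAt (nth λ') (nth β) w p ≡ g p) w≡m
                                 (λ p p<m → parts p (subst (p <_) (sym w≡m) p<m))

-- φ is well defined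

Antitone : (ℕ → ℕ) → Set
Antitone ℓ = ∀ {r r'} → r ≤ r' → ℓ r' ≤ ℓ r

Decreasing⇒nth-step : ∀ {xs} → Decreasing xs → ∀ r → nth xs (suc r) ≤ nth xs r
Decreasing⇒nth-step dec[]             r       = z≤n
Decreasing⇒nth-step dec[ x ]          r       = z≤n
Decreasing⇒nth-step (dec∷ y≤x _)      zero    = y≤x
Decreasing⇒nth-step (dec∷ _ dec-tail) (suc r) = Decreasing⇒nth-step dec-tail r

nth-step⇒Decreasing : ∀ xs → (∀ r → nth xs (suc r) ≤ nth xs r) → Decreasing xs
nth-step⇒Decreasing []           _    = dec[]
nth-step⇒Decreasing (x ∷ [])     _    = dec[ x ]
nth-step⇒Decreasing (x ∷ y ∷ ys) step = dec∷ (step 0) (nth-step⇒Decreasing (y ∷ ys) (λ r → step (suc r)))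

step⇒Antitone : ∀ ℓ → (∀ r → ℓ (suc r) ≤ ℓ r) → Antitone ℓ
step⇒Antitone ℓ step {r} {zero}    r≤0   = ≤-reflexive (cong ℓ (sym (n≤0⇒n≡0 r≤0)))
step⇒Antitone ℓ step {r} {suc r'} r≤1+r' with m≤n⇒m<n∨m≡n r≤1+r'
... | inj₁ r<1+r' = ≤-trans (step r') (step⇒Antitone ℓ step (s≤s⁻¹ r<1+r'))
... | inj₂ refl   = ≤-refl

φAt-preserves-Above : ∀ ℓ f m → Antitone ℓ → ∀ k j → k < m → Above f k j → Above (φAt ℓ f m) k j
φAt-preserves-Above ℓ f m antitone k j k<m k>j = above k>j (m≤n⇒m<n∨m≡n ℓrj≤ℓrk)
  where
  ℓrj≤ℓrk : ℓ (rankAt f m j) ≤ ℓ (rankAt f m k)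
  ℓrj≤ℓrk = antitone (<⇒≤ (Above⇒rankAt-< f m k j k<m k>j))
  above : Above f k j → ℓ (rankAt f m j) < ℓ (rankAt f m k) ⊎ ℓ (rankAt f m j) ≡ ℓ (rankAt f m k) → Above (φAt ℓ f m) k j
  above (inj₁ fj<fk)         _               = inj₁ (+-mono-<-≤ fj<fk ℓrj≤ℓrk)
  above (inj₂ (fj≡fk , _))   (inj₁ ℓrj<ℓrk) = inj₁ (+-mono-≤-< (≤-reflexive fj≡fk) ℓrj<ℓrk)
  above (inj₂ (fj≡fk , j<k)) (inj₂ ℓrj≡ℓrk) = inj₂ (cong₂ _+_ fj≡fk ℓrj≡ℓrk , j<k)

rankAt-φAt : ∀ ℓ f m → Antitone ℓ → ∀ j → j < m → rankAt (φAt ℓ f m) m j ≡ rankAt f m j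
rankAt-φAt ℓ f m antitone = rankAt-preserved f (φAt ℓ f m) m (λ k j k<m _ → φAt-preserves-Above ℓ f m antitone k j k<m)

⊔-right : ∀ {m n j} → m ≤ j → j < m ⊔ n → m ⊔ n ≡ n
⊔-right {m} {n} m≤j j<m⊔n with ≤-total m n
... | inj₁ m≤n = m≤n⇒m⊔n≡n m≤n
... | inj₂ n≤m = ⊥-elim (<-irrefl refl (<-≤-trans (subst (_ <_) (m≥n⇒m⊔n≡m n≤m) j<m⊔n) m≤j))

sum-φ : ∀ λ' β → sum (φ λ' β) ≡ sum λ' + sum β
sum-φ λ' β = begin
  sum (φ λ' β)                                      ≡⟨ cong sum (φ-applyUpTo λ' β) ⟩
  sum (applyUpTo (φAt ℓ f w) w)                     ≡⟨ sum-applyUpTo _ w ⟩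
  sumBelow (φAt ℓ f w) w                            ≡⟨ sumBelow-+ f _ w ⟩
  sumBelow f w + sumBelow (ℓ ∘ rankAt f w) w        ≡⟨ cong (sumBelow f w +_) (sumBelow-rankAt f w ℓ) ⟩
  sumBelow f w + sumBelow ℓ w
    ≡⟨ sym (cong₂ _+_ (sum-sumBelow β w (m≤m⊔n _ _)) (sum-sumBelow λ' w (m≤n⊔m _ _))) ⟩
  sum β + sum λ'                                    ≡⟨ +-comm (sum β) (sum λ') ⟩
  sum λ' + sum β                                    ∎
  where
  open ≡-Reasoning
  w = width λ' β
  f = nth β
  ℓ = nth λ'

φ-InC : ∀ n d λ' β → InPB n d λ' β → InC n d (φ λ' β)
φ-InC n d λ' β ((λ'>0 , _) , ℓλ'≤n , (β>0 , _ , _ , ℓβ≤n) , |λ'|+|β|≡d) =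
  composition , trans (sum-φ λ' β) |λ'|+|β|≡d , subst (_≤ n) (sym ℓφ≡w) (⊔-lub ℓβ≤n ℓλ'≤n)
  where
  w = width λ' β
  f = nth β
  h = φAt (nth λ') f w
  ℓφ≡w : length (φ λ' β) ≡ w
  ℓφ≡w = trans (cong length (φ-applyUpTo λ' β)) (length-applyUpTo h w)
  positive : ∀ j → j < w → 0 < h j
  positive j j<w with j <? length β
  ... | yes j<ℓβ = <-≤-trans (nth-positive β>0 j j<ℓβ) (m≤m+n _ _)
  ... | no  j≮ℓβ = <-≤-trans (nth-positive λ'>0 _ rank<ℓλ') (m≤n+m _ _)
    where
    rank<ℓλ' : rankAt f w j < length λ'
    rank<ℓλ' = subst (rankAt f w j <_) (⊔-right (≮⇒≥ j≮ℓβ) j<w) (rankAt<m f w j j<w)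
  composition : IsComposition (φ λ' β)
  composition = subst IsComposition (sym (φ-applyUpTo λ' β)) (applyUpTo⁺₁ h w (λ {j} → positive j))

-- Tails, shifts and purity

shift : List ℕ → ℕ → List ℕ
shift β j = map suc β ++ replicate j 1

length-shift : ∀ β j → length (shift β j) ≡ length β + j
length-shift β j = trans (length-++ (map suc β)) (cong₂ _+_ (length-map suc β) (length-replicate j))

nth-shift : ∀ β j p → p < length β + j → nth (shift β j) p ≡ suc (nth β p)
nth-shift β j p p<ℓ with p <? length β
... | yes p<ℓβ = trans (nth-++ˡ (map suc β) _ p (subst (p <_) (sym (length-map suc β)) p<ℓβ)) (nth-map-suc β p p<ℓβ)
  where
  nth-map-suc : ∀ xs p → p < length xs → nth (map suc xs) p ≡ suc (nth xs p)
  nth-map-suc (x ∷ xs) zero    _         = refl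
  nth-map-suc (x ∷ xs) (suc p) (s<s p<ℓ) = nth-map-suc xs p p<ℓ
... | no  p≮ℓβ = begin
  nth (shift β j) p                              ≡⟨ nth-++ʳ (map suc β) _ p (subst (_≤ p) (sym (length-map suc β)) ℓβ≤p) ⟩
  nth (replicate j 1) (p ∸ length (map suc β))   ≡⟨ cong (λ ℓ → nth (replicate j 1) (p ∸ ℓ)) (length-map suc β) ⟩
  nth (replicate j 1) (p ∸ length β)
    ≡⟨ nth-replicate j 1 _ (subst (p ∸ length β <_) (m+n∸m≡n (length β) j) (∸-monoˡ-< p<ℓ ℓβ≤p)) ⟩
  1                                              ≡⟨ cong suc (sym (nth-beyond β p ℓβ≤p)) ⟩
  suc (nth β p)                                  ∎
  where
  open ≡-Reasoning
  ℓβ≤p : length β ≤ p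
  ℓβ≤p = ≮⇒≥ p≮ℓβ

shift-++ : ∀ γ δ j → shift (γ ++ δ) j ≡ map suc γ ++ shift δ j
shift-++ γ δ j = trans (cong (_++ replicate j 1) (map-++ suc γ δ)) (++-assoc (map suc γ) (map suc δ) _)

length-∷ʳ : ∀ (ms : List ℕ) j → length (ms ∷ʳ j) ≡ suc (length ms)
length-∷ʳ ms j = trans (length-++ ms) (+-comm (length ms) 1)

stair-∷ʳ : ∀ ms j → stair (ms ∷ʳ j) ≡ shift (stair ms) j
stair-∷ʳ []       j = ++-identityʳ _
stair-∷ʳ (m ∷ ms) j = begin
  replicate m (suc (length (ms ∷ʳ j))) ++ stair (ms ∷ʳ j)
    ≡⟨ cong₂ (λ ℓ s → replicate m (suc ℓ) ++ s) (length-∷ʳ ms j) (stair-∷ʳ ms j) ⟩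
  replicate m (suc (suc (length ms))) ++ shift (stair ms) j
    ≡⟨ cong (_++ shift (stair ms) j) (sym (map-replicate suc m (suc (length ms)))) ⟩
  map suc (replicate m (suc (length ms))) ++ shift (stair ms) j
    ≡⟨ sym (shift-++ (replicate m (suc (length ms))) (stair ms) j) ⟩
  shift (replicate m (suc (length ms)) ++ stair ms) j ∎
  where open ≡-Reasoning

stair-positive : ∀ ms → All (0 <_) (stair ms)
stair-positive []       = []
stair-positive (m ∷ ms) = ++⁺ (replicate⁺ m z<s) (stair-positive ms)

map-suc-pred : ∀ xs → All (0 <_) xs → map suc (map pred xs) ≡ xs
map-suc-pred []             _            = refl
map-suc-pred (suc x ∷ xs) (_ ∷ xs>0) = cong (suc x ∷_) (map-suc-pred xs xs>0)

HasTail-shift⁺ : ∀ {β k} → HasTail β k → ∀ j → 0 < j → HasTail (shift β j) (suc k)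
HasTail-shift⁺ {β} (γ , ms , refl , ms>0 , γ>k , refl) j j>0 =
  map suc γ , ms ∷ʳ j , length-∷ʳ ms j , ++⁺ ms>0 (j>0 ∷ []) , map⁺ (All.map s<s γ>k) ,
  trans (shift-++ γ (stair ms) j) (cong (map suc γ ++_) (sym (stair-∷ʳ ms j)))

strip-ones : ∀ xs ys a b → All (1 <_) xs → All (1 <_) ys → xs ++ replicate a 1 ≡ ys ++ replicate b 1 → xs ≡ ys
strip-ones []       []       a       b       _          _          _  = refl
strip-ones []       (y ∷ ys) (suc a) b       _          (y>1 ∷ _)  eq = ⊥-elim (<-irrefl (proj₁ (∷-injective eq)) y>1)
strip-ones (x ∷ xs) []       a       (suc b) (x>1 ∷ _)  _          eq = ⊥-elim (<-irrefl (sym (proj₁ (∷-injective eq))) x>1)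
strip-ones (x ∷ xs) (y ∷ ys) a       b       (_ ∷ xs>1) (_ ∷ ys>1) eq =
  cong₂ _∷_ (proj₁ (∷-injective eq)) (strip-ones xs ys a b xs>1 ys>1 (proj₂ (∷-injective eq)))

HasTail-shift⁻ : ∀ {β j k} → All (0 <_) β → HasTail (shift β j) (suc k) → HasTail β k
HasTail-shift⁻ {β} {j} {k} β>0 (γ , ms′ , ℓms′ , ms′>0 , γ>k , eq) with initLast ms′
... | []        = ⊥-elim (0≢1+n ℓms′)
... | ms ∷ʳ′ j′ =
  map pred γ , ms , suc-injective (trans (sym (length-∷ʳ ms j′)) ℓms′) , proj₁ (∷ʳ⁻ ms′>0) ,
  map⁺ (All.map pred-> γ>k) , map-injective suc-injective β-eq
  where
  pred-> : ∀ {x} → suc k < x → k < pred x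
  pred-> (s<s k<x) = k<x
  γ>0 : All (0 <_) γ
  γ>0 = All.map (<-trans z<s) γ>k
  stripped : map suc β ≡ γ ++ map suc (stair ms)
  stripped = strip-ones _ _ j j′ (map⁺ (All.map s<s β>0))
    (++⁺ (All.map (≤-trans (s≤s (s≤s z≤n))) γ>k) (map⁺ (All.map s<s (stair-positive ms))))
    (trans eq (trans (cong (γ ++_) (stair-∷ʳ ms j′)) (sym (++-assoc γ _ _))))
  β-eq : map suc β ≡ map suc (map pred γ ++ stair ms)
  β-eq = trans stripped (trans (cong (_++ map suc (stair ms)) (sym (map-suc-pred γ γ>0))) (sym (map-++ suc (map pred γ) (stair ms))))

Shifted : List ℕ → Set
Shifted α = ∃[ β ] ∃[ j ] (0 < j × All (0 <_) β × α ≡ shift β j)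

HasTail⇒Shifted : ∀ {α k} → HasTail α (suc k) → Shifted α
HasTail⇒Shifted {α} {k} (γ , ms′ , ℓms′ , ms′>0 , γ>k , eq) with initLast ms′
... | []        = ⊥-elim (0≢1+n ℓms′)
... | ms ∷ʳ′ j′ =
  map pred γ ++ stair ms , j′ , proj₂ (∷ʳ⁻ ms′>0) , ++⁺ (map⁺ (All.map pred-pos γ>k)) (stair-positive ms) ,
  trans eq (trans (cong (γ ++_) (stair-∷ʳ ms j′))
    (trans (cong (_++ shift (stair ms) j′) (sym (map-suc-pred γ (All.map (<-trans z<s) γ>k))))
           (sym (shift-++ (map pred γ) (stair ms) j′))))
  where
  pred-pos : ∀ {x} → suc k < x → 0 < pred x
  pred-pos (s<s (s<s _)) = z<s

MaxTail : List ℕ → ℕ → Set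
MaxTail α K = HasTail α K × (∀ k → HasTail α k → k ≤ K)

MaxTail-unique : ∀ {α K K′} → MaxTail α K → MaxTail α K′ → K ≡ K′
MaxTail-unique (tK , maxK) (tK′ , maxK′) = ≤-antisym (maxK′ _ tK) (maxK _ tK′)

MaxTail-shift⁺ : ∀ {β j K} → All (0 <_) β → 0 < j → MaxTail β K → MaxTail (shift β j) (suc K)
MaxTail-shift⁺ {β} {j} {K} β>0 j>0 (tK , maxK) = HasTail-shift⁺ tK j j>0 , bound
  where
  bound : ∀ k → HasTail (shift β j) k → k ≤ suc K
  bound zero    _ = z≤n
  bound (suc k) t = s≤s (maxK k (HasTail-shift⁻ β>0 t))

MaxTail-shift⁻ : ∀ {β j K} → All (0 <_) β → 0 < j → MaxTail (shift β j) (suc K) → MaxTail β K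
MaxTail-shift⁻ {j = j} β>0 j>0 (tK , maxK) =
  HasTail-shift⁻ β>0 tK , λ k t → s≤s⁻¹ (maxK (suc k) (HasTail-shift⁺ t j j>0))

Even⇒¬Even-suc : ∀ {k} → Even k → ¬ Even (suc k)
Even⇒¬Even-suc (even-ss ev) (even-ss ev′) = Even⇒¬Even-suc ev ev′

Pure⇒¬Pure-shift : ∀ {β j} → All (0 <_) β → 0 < j → Pure β → ¬ Pure (shift β j)
Pure⇒¬Pure-shift β>0 j>0 (K , tK , maxK , evK) (K′ , tK′ , maxK′ , evK′) =
  Even⇒¬Even-suc evK (subst Even (MaxTail-unique (tK′ , maxK′) (MaxTail-shift⁺ β>0 j>0 (tK , maxK))) evK′)

Shifted? : ∀ α → All (0 <_) α → Dec (Shifted α)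
Shifted? [] _ = no λ { ([] , suc j , _ , _ , ()) ; (_ ∷ _ , _ , _ , _ , ()) }
Shifted? (x ∷ xs) (_ ∷ xs>0) with Shifted? xs xs>0
Shifted? (suc (suc y) ∷ xs) _ | yes (β , j , j>0 , β>0 , refl) =
  yes (suc y ∷ β , j , j>0 , z<s ∷ β>0 , refl)
Shifted? (1 ∷ xs) _ | yes ([] , j , _ , _ , refl) =
  yes ([] , suc j , z<s , [] , refl)
Shifted? (1 ∷ xs) _ | yes (b ∷ β , j , _ , b>0 ∷ _ , refl) = no one-before-bigger
  where
  one-before-bigger : ¬ Shifted (1 ∷ suc b ∷ map suc β ++ replicate j 1)
  one-before-bigger ([]        , suc (suc j′) , _ , _ , eq) =
    <-irrefl (sym (suc-injective (proj₁ (∷-injective (proj₂ (∷-injective eq)))))) b>0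
  one-before-bigger (zero ∷ _  , _ , _ , () ∷ _ , _)
Shifted? (1 ∷ []) _ | no _ = yes ([] , 1 , z<s , [] , refl)
Shifted? (suc (suc y) ∷ []) _ | no _ = no λ
  { ([] , suc j , _ , _ , ()) ; (_ ∷ [] , suc j , _ , _ , ()) ; (_ ∷ _ ∷ _ , _ , _ , _ , ()) }
Shifted? (suc x ∷ y ∷ ys) _ | no ¬shifted = no λ
  { ([] , suc (suc j) , _ , _ , eq) → ¬shifted ([] , suc j , z<s , [] , proj₂ (∷-injective eq))
  ; (_ ∷ β , j , j>0 , _ ∷ β>0 , eq) → ¬shifted (β , j , j>0 , β>0 , proj₂ (∷-injective eq)) }

HasTail-zero : ∀ {α} → All (0 <_) α → HasTail α 0
HasTail-zero {α} α>0 = α , [] , refl , [] , α>0 , sym (++-identityʳ α)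

MaxTail-exists : ∀ α → All (0 <_) α → ∃[ K ] MaxTail α K
MaxTail-exists α = go (length α) α ≤-refl
  where
  go : ∀ n α → length α ≤ n → All (0 <_) α → ∃[ K ] MaxTail α K
  go n α ℓ≤n α>0 with Shifted? α α>0
  ... | no ¬shifted = 0 , HasTail-zero α>0 , bound
    where
    bound : ∀ k → HasTail α k → k ≤ 0
    bound zero    _ = z≤n
    bound (suc k) t = ⊥-elim (¬shifted (HasTail⇒Shifted t))
  go zero    α ℓ≤n α>0 | yes (β , j , j>0 , β>0 , refl) =
    ⊥-elim (<-irrefl refl (<-≤-trans (<-≤-trans j>0 (m≤n+m j (length β))) (subst (_≤ 0) (length-shift β j) ℓ≤n)))
  go (suc n) α ℓ≤n α>0 | yes (β , j , j>0 , β>0 , refl) with go n β ℓβ≤n β>0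
    where
    ℓβ≤n : length β ≤ n
    ℓβ≤n = s≤s⁻¹ (≤-trans (subst (_≤ length β + j) (+-comm (length β) 1) (+-monoʳ-≤ (length β) j>0))
                          (subst (_≤ suc n) (length-shift β j) ℓ≤n))
  ... | K , maxTail = suc K , MaxTail-shift⁺ β>0 j>0 maxTail

-- Inverting compositions

InvertingBelow : (ℕ → ℕ) → ℕ → Set
InvertingBelow f m = ∀ i → 1 < i → ∃[ p ] (p < m × i ≤ f p) →
  ∃[ s ] ∃[ t ] (s < t × t < m × f s ≡ i × f t ≡ pred i)

nth≤maxPart : ∀ xs j → nth xs j ≤ maxPart xs
nth≤maxPart []       j       = z≤n
nth≤maxPart (x ∷ xs) zero    = m≤m⊔n x _
nth≤maxPart (x ∷ xs) (suc j) = ≤-trans (nth≤maxPart xs j) (m≤n⊔m x _)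

maxPart-attained : ∀ x xs → ∃[ p ] (p < length (x ∷ xs) × maxPart (x ∷ xs) ≤ nth (x ∷ xs) p)
maxPart-attained x []       = 0 , z<s , ≤-reflexive (⊔-identityʳ x)
maxPart-attained x (y ∷ ys) with maxPart-attained y ys | x ≤? maxPart (y ∷ ys)
... | p , p<ℓ , max≤ | yes x≤max = suc p , s<s p<ℓ , subst (_≤ nth (y ∷ ys) p) (sym (m≤n⇒m⊔n≡n x≤max)) max≤
... | _              | no  x≰max = 0 , z<s , ≤-reflexive (m≥n⇒m⊔n≡m (<⇒≤ (≰⇒> x≰max)))

lookup-nth : ∀ xs (i : Fin (length xs)) → lookup xs i ≡ nth xs (toℕ i)
lookup-nth (x ∷ xs) Fin.zero    = refl
lookup-nth (x ∷ xs) (Fin.suc i) = lookup-nth xs i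

Inverting⇒InvertingBelow : ∀ β m → Inverting β → length β ≤ m → InvertingBelow (nth β) m
Inverting⇒InvertingBelow β m inverting ℓ≤m i i>1 (p , _ , i≤βp)
  with inverting i i>1 (≤-trans i≤βp (nth≤maxPart β p))
... | s , t , s<t , βs≡i , βt≡i-1 =
  toℕ s , toℕ t , s<t , ≤-trans (toℕ<n t) ℓ≤m , trans (sym (lookup-nth β s)) βs≡i , trans (sym (lookup-nth β t)) βt≡i-1

InvertingBelow⇒Inverting : ∀ α → InvertingBelow (nth α) (length α) → Inverting α
InvertingBelow⇒Inverting []       _         (suc (suc i)) _   ()
InvertingBelow⇒Inverting (x ∷ xs) inverting i             i>1 i≤max with maxPart-attained x xs
... | p , p<ℓ , max≤ with inverting i i>1 (p , p<ℓ , ≤-trans i≤max max≤)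
... | s , t , s<t , t<ℓ , αs≡i , αt≡i-1 =
  fromℕ< s<ℓ , fromℕ< t<ℓ , subst₂ _<_ (sym (toℕ-fromℕ< s<ℓ)) (sym (toℕ-fromℕ< t<ℓ)) s<t ,
  at s s<ℓ αs≡i , at t t<ℓ αt≡i-1
  where
  α = x ∷ xs
  s<ℓ : s < length α
  s<ℓ = <-trans s<t t<ℓ
  at : ∀ p (p<ℓ : p < length α) {v} → nth α p ≡ v → lookup α (fromℕ< p<ℓ) ≡ v
  at p p<ℓ αp≡v = trans (lookup-nth α (fromℕ< p<ℓ)) (trans (cong (nth α) (toℕ-fromℕ< p<ℓ)) αp≡v)

values-attained : ∀ f m → InvertingBelow f m → ∀ v → 0 < v → ∃[ p ] (p < m × v ≤ f p) → ∃[ q ] (q < m × f q ≡ v)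
values-attained f m inverting (suc (suc v)) _ exceeded with inverting (suc (suc v)) (s<s z<s) exceeded
... | s , t , s<t , t<m , fs≡v , _ = s , <-trans s<t t<m , fs≡v
values-attained f m inverting 1 _ (p , p<m , 1≤fp) with f p in fp≡
... | 1           = p , p<m , fp≡
... | suc (suc _) with inverting 2 (s<s z<s) (p , p<m , subst (2 ≤_) (sym fp≡) (s<s (s<s z≤n)))
...   | s , t , s<t , t<m , _ , ft≡1 = t , t<m , ft≡1

-- The gap between a part and the next one in rank order: equal parts are ranked by position,
-- so a part above a later part is strictly larger.
ε : ℕ → ℕ → ℕ
ε j k = fromBool (j <ᵇ k)

ε-view : ∀ j k → (j < k × ε j k ≡ 1) ⊎ (k ≤ j × ε j k ≡ 0)
ε-view j k with j <ᵇ k | <ᵇ-reflects-< j k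
... | true  | ofʸ j<k = inj₁ (j<k , refl)
... | false | ofⁿ j≮k = inj₂ (≮⇒≥ j≮k , refl)

ZerosLast : (ℕ → ℕ) → Set
ZerosLast f = ∀ j k → f k ≡ 0 → 0 < f j → j < k

Adjacent : (ℕ → ℕ) → ℕ → ℕ → ℕ → Set
Adjacent f m j k = rankAt f m k ≡ suc (rankAt f m j)

module _ (f : ℕ → ℕ) (m : ℕ) where

  nothing-between : ∀ {j k p} → j < m → p < m → Adjacent f m j k → Above f j p → Above f p k → ⊥
  nothing-between {j} {k} {p} j<m p<m adjacent j>p p>k =
    ≤⇒≯ (s≤s⁻¹ (subst (rankAt f m p <_) adjacent (Above⇒rankAt-< f m p k p<m p>k))) (Above⇒rankAt-< f m j p j<m j>p)

  Adjacent⇒Above : ∀ {j k} → j < m → k < m → Adjacent f m j k → Above f j k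
  Adjacent⇒Above {j} {k} j<m k<m adjacent = rankAt-<⇒Above f m j k j<m k<m (subst (rankAt f m j <_) (sym adjacent) ≤-refl)

  lowest-minimal : ∀ {b} → b < m → suc (rankAt f m b) ≡ m → ∀ j → j < m → f b ≤ f j
  lowest-minimal {b} b<m lowest j j<m =
    proj₁ (rankAt-≤⇒parts-≥ f m j<m b<m (s≤s⁻¹ (subst (rankAt f m j <_) (sym lowest) (rankAt<m f m j j<m))))

  InvertingBelow⇒lowest≤1 : InvertingBelow f m → ∀ {b} → b < m → suc (rankAt f m b) ≡ m → f b ≤ 1
  InvertingBelow⇒lowest≤1 inverting {b} b<m lowest with f b ≟ 0
  ... | yes fb≡0 = subst (_≤ 1) (sym fb≡0) z≤n
  ... | no  fb≢0 with values-attained f m inverting 1 z<s (b , b<m , n≢0⇒n>0 fb≢0)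
  ...   | q , q<m , fq≡1 = subst (f b ≤_) fq≡1 (lowest-minimal b<m lowest q q<m)

  adjacent-gap-1⇒< : InvertingBelow f m → ZerosLast f → ∀ {j k} → j < m → Adjacent f m j k → f j ≡ suc (f k) → j < k
  adjacent-gap-1⇒< inverting zeros-last {j} {k} j<m adjacent fj≡1+fk with f k ≟ 0
  ... | yes fk≡0 = zeros-last j k fk≡0 (subst (0 <_) (sym fj≡1+fk) z<s)
  ... | no  fk≢0 with inverting (f j) (subst (1 <_) (sym fj≡1+fk) (s<s (n≢0⇒n>0 fk≢0))) (j , j<m , ≤-refl)
  ...   | s , t , s<t , t<m , fs≡fj , ft≡fj-1 = ≤-<-trans j≤s (<-≤-trans s<t t≤k)
    where
    ft≡fk : f t ≡ f k
    ft≡fk = trans ft≡fj-1 (cong pred fj≡1+fk)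
    fk<fj : f k < f j
    fk<fj = subst (f k <_) (sym fj≡1+fk) ≤-refl
    j≤s : j ≤ s
    j≤s with j ≤? s
    ... | yes j≤s = j≤s
    ... | no  j≰s = ⊥-elim (nothing-between j<m (<-trans s<t t<m) adjacent
                              (inj₂ (fs≡fj , ≰⇒> j≰s)) (inj₁ (subst (f k <_) (sym fs≡fj) fk<fj)))
    t≤k : t ≤ k
    t≤k with t ≤? k
    ... | yes t≤k = t≤k
    ... | no  t≰k = ⊥-elim (nothing-between j<m t<m adjacent
                              (inj₁ (subst (_< f j) (sym ft≡fk) fk<fj)) (inj₂ (sym ft≡fk , ≰⇒> t≰k)))

  InvertingBelow⇒adjacent : InvertingBelow f m → ZerosLast f →
                            ∀ {j k} → j < m → k < m → Adjacent f m j k → f j ≡ f k + ε j k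
  InvertingBelow⇒adjacent inverting zeros-last {j} {k} j<m k<m adjacent = by-order (Adjacent⇒Above j<m k<m adjacent) (ε-view j k)
    where
    by-order : Above f j k → (j < k × ε j k ≡ 1) ⊎ (k ≤ j × ε j k ≡ 0) → f j ≡ f k + ε j k
    by-order (inj₂ (fk≡fj , _)) (inj₂ (_ , ε≡0)) = sym (trans (cong (f k +_) ε≡0) (trans (+-identityʳ (f k)) fk≡fj))
    by-order (inj₂ (_ , k<j))   (inj₁ (j<k , _)) = ⊥-elim (<-asym j<k k<j)
    by-order (inj₁ fk<fj) view with <-cmp (f j) (suc (f k))
    ... | tri< fj<1+fk _ _ = ⊥-elim (≤⇒≯ (s≤s⁻¹ fj<1+fk) fk<fj)
    ... | tri> _ _ fj>1+fk with values-attained f m inverting (suc (f k)) z<s (j , j<m , <⇒≤ fj>1+fk)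
    ...   | q , q<m , fq≡1+fk = ⊥-elim (nothing-between j<m q<m adjacent
                                 (inj₁ (subst (_< f j) (sym fq≡1+fk) fj>1+fk)) (inj₁ (subst (f k <_) (sym fq≡1+fk) ≤-refl)))
    by-order (inj₁ fk<fj) (inj₁ (_ , ε≡1)) | tri≈ _ fj≡1+fk _ =
      trans fj≡1+fk (trans (+-comm 1 (f k)) (cong (f k +_) (sym ε≡1)))
    by-order (inj₁ fk<fj) (inj₂ (k≤j , _)) | tri≈ _ fj≡1+fk _ =
      ⊥-elim (<⇒≱ (adjacent-gap-1⇒< inverting zeros-last j<m adjacent fj≡1+fk) k≤j)

module _ (f : ℕ → ℕ) (m : ℕ) where

  AdjacentTight : Set
  AdjacentTight = ∀ j k → j < m → k < m → Adjacent f m j k → f j ≤ f k + ε j k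

  LowestTight : Set
  LowestTight = ∀ b → b < m → suc (rankAt f m b) ≡ m → f b ≤ 1

  -- For i > 1 take the lowest-ranked part j with value ≥ i; the part k just below it is < i,
  -- and tightness forces f j = i, f k = i - 1 and j < k.
  tight⇒InvertingBelow : AdjacentTight → LowestTight → InvertingBelow f m
  tight⇒InvertingBelow adjacent-tight lowest-tight i i>1 exceeded
    with argmax< (λ q → i ≤? f q) (rankAt f m) m exceeded
  ... | j , j<m , i≤fj , lowest-exceeding with suc (rankAt f m j) <? m
  ...   | no  1+rj≮m = ⊥-elim (<-irrefl refl (<-≤-trans i>1 (≤-trans i≤fj
                          (lowest-tight j j<m (≤-antisym (rankAt<m f m j j<m) (≮⇒≥ 1+rj≮m))))))
  ...   | yes 1+rj<m with rankAt-surjective f m (suc (rankAt f m j)) 1+rj<m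
  ...     | k , k<m , adjacent = by-position (ε-view j k)
    where
    fk<i : f k < i
    fk<i with i ≤? f k
    ... | yes i≤fk = ⊥-elim (<-irrefl adjacent (s≤s (lowest-exceeding k k<m i≤fk)))
    ... | no  i≰fk = ≰⇒> i≰fk
    tight : f j ≤ f k + ε j k
    tight = adjacent-tight j k j<m k<m adjacent
    by-position : (j < k × ε j k ≡ 1) ⊎ (k ≤ j × ε j k ≡ 0) →
                  ∃[ s ] ∃[ t ] (s < t × t < m × f s ≡ i × f t ≡ pred i)
    by-position (inj₂ (_ , ε≡0)) =
      ⊥-elim (<-irrefl refl (<-≤-trans fk<i (≤-trans i≤fj
        (subst (f j ≤_) (trans (cong (f k +_) ε≡0) (+-identityʳ (f k))) tight))))
    by-position (inj₁ (j<k , ε≡1)) = j , k , j<k , k<m , fj≡i , fk≡i-1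
      where
      fj≤1+fk : f j ≤ suc (f k)
      fj≤1+fk = subst (f j ≤_) (trans (cong (f k +_) ε≡1) (+-comm (f k) 1)) tight
      fj≡i : f j ≡ i
      fj≡i = ≤-antisym (≤-trans fj≤1+fk fk<i) i≤fj
      fk≡i-1 : f k ≡ pred i
      fk≡i-1 = ≤-antisym (pred-mono-≤ fk<i) (subst (λ v → pred v ≤ f k) fj≡i (pred-mono-≤ fj≤1+fk))

-- Injectivity

module _ (f₁ f₂ : ℕ → ℕ) (m : ℕ)
         (same-rank : ∀ j → j < m → rankAt f₂ m j ≡ rankAt f₁ m j)
         (tight₁ : ∀ {j k} → j < m → k < m → Adjacent f₁ m j k → f₁ j ≡ f₁ k + ε j k)
         (tight₂ : ∀ {j k} → j < m → k < m → Adjacent f₂ m j k → f₂ j ≡ f₂ k + ε j k) where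

  -- Walking down the common rank order from j to the lowest part b, both functions drop by the same steps ε.
  offset-from-lowest : ∀ {b} → b < m → suc (rankAt f₁ m b) ≡ m → ∀ j → j < m → f₁ j + f₂ b ≡ f₂ j + f₁ b
  offset-from-lowest {b} b<m lowest j j<m = go (m ∸ suc (rankAt f₁ m j)) j j<m (m+[n∸m]≡n (rankAt<m f₁ m j j<m))
    where
    go : ∀ t j → j < m → suc (rankAt f₁ m j) + t ≡ m → f₁ j + f₂ b ≡ f₂ j + f₁ b
    go zero j j<m ≡m with rankAt-injective f₁ m j b j<m b<m (suc-injective (trans (trans (sym (+-identityʳ _)) ≡m) (sym lowest)))
    ... | refl = +-comm (f₁ j) (f₂ j)
    go (suc t) j j<m ≡m with rankAt-surjective f₁ m (suc (rankAt f₁ m j)) (subst (suc (rankAt f₁ m j) <_) ≡m (m<m+n _ z<s))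
    ... | k , k<m , adjacent₁ = begin
      f₁ j + f₂ b         ≡⟨ cong (_+ f₂ b) (tight₁ j<m k<m adjacent₁) ⟩
      f₁ k + ε j k + f₂ b ≡⟨ xy∙z≈xz∙y (f₁ k) (ε j k) (f₂ b) ⟩
      f₁ k + f₂ b + ε j k ≡⟨ cong (_+ ε j k) (go t k k<m k-distance) ⟩
      f₂ k + f₁ b + ε j k ≡⟨ xy∙z≈xz∙y (f₂ k) (f₁ b) (ε j k) ⟩
      f₂ k + ε j k + f₁ b ≡⟨ cong (_+ f₁ b) (sym (tight₂ j<m k<m adjacent₂)) ⟩
      f₂ j + f₁ b         ∎
      where
      open ≡-Reasoning
      k-distance : suc (rankAt f₁ m k) + t ≡ m
      k-distance = trans (cong (λ r → suc r + t) adjacent₁) (trans (sym (+-suc _ t)) ≡m)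
      adjacent₂ : Adjacent f₂ m j k
      adjacent₂ = trans (same-rank k k<m) (trans adjacent₁ (cong suc (sym (same-rank j j<m))))

nth-ZerosLast : ∀ {β} → All (0 <_) β → ZerosLast (nth β)
nth-ZerosLast {β} β>0 j k βk≡0 βj>0 with k <? length β | j <? length β
... | yes k<ℓ | _        = ⊥-elim (<-irrefl (sym βk≡0) (nth-positive β>0 k k<ℓ))
... | no  k≮ℓ | yes j<ℓ = <-≤-trans j<ℓ (≮⇒≥ k≮ℓ)
... | no  _   | no  j≮ℓ = ⊥-elim (<-irrefl (sym (nth-beyond β j (≮⇒≥ j≮ℓ))) βj>0)

shift-from-nth : ∀ {β₁ β₂ m} → All (0 <_) β₁ → length β₁ ≤ m → length β₂ < m →
                 (∀ j → j < m → nth β₁ j ≡ suc (nth β₂ j)) → β₁ ≡ shift β₂ (m ∸ length β₂)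
shift-from-nth {β₁} {β₂} {m} β₁>0 ℓ₁≤m ℓ₂<m β₁≡1+β₂ = nth-ext β₁ (shift β₂ (m ∸ length β₂)) ℓ≡ λ j j<ℓ →
  let j<m = <-≤-trans j<ℓ ℓ₁≤m in
  trans (β₁≡1+β₂ j j<m) (sym (nth-shift β₂ _ j (subst (j <_) (sym ℓ₂+[m∸ℓ₂]≡m) j<m)))
  where
  ℓ₂+[m∸ℓ₂]≡m : length β₂ + (m ∸ length β₂) ≡ m
  ℓ₂+[m∸ℓ₂]≡m = m+[n∸m]≡n (<⇒≤ ℓ₂<m)
  ℓ₁≡m : length β₁ ≡ m
  ℓ₁≡m with length β₁ <? m
  ... | no  ℓ₁≮m = ≤-antisym ℓ₁≤m (≮⇒≥ ℓ₁≮m)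
  ... | yes ℓ₁<m = ⊥-elim (0≢1+n (trans (sym (nth-beyond β₁ _ ≤-refl)) (β₁≡1+β₂ _ ℓ₁<m)))
  ℓ≡ : length β₁ ≡ length (shift β₂ (m ∸ length β₂))
  ℓ≡ = trans ℓ₁≡m (sym (trans (length-shift β₂ _) ℓ₂+[m∸ℓ₂]≡m))

pure-not-shift-of-pure : ∀ {βa βb m} → All (0 <_) βa → All (0 <_) βb → Pure βa → Pure βb →
                         length βa ≤ m → length βb < m → ¬ (∀ j → j < m → nth βa j ≡ suc (nth βb j))
pure-not-shift-of-pure {βa} {βb} {m} βa>0 βb>0 pure-a pure-b ℓa≤m ℓb<m βa≡1+βb =
  Pure⇒¬Pure-shift βb>0 (m<n⇒0<n∸m ℓb<m) pure-b
    (subst Pure (shift-from-nth {β₂ = βb} βa>0 ℓa≤m ℓb<m βa≡1+βb) pure-a)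

nth≡0⇒length≤ : ∀ {β} → All (0 <_) β → ∀ b → nth β b ≡ 0 → length β ≤ b
nth≡0⇒length≤ {β} β>0 b βb≡0 with b <? length β
... | yes b<ℓ = ⊥-elim (<-irrefl (sym βb≡0) (nth-positive β>0 b b<ℓ))
... | no  b≮ℓ = ≮⇒≥ b≮ℓ

≤1⇒≡0⊎≡1 : ∀ {x} → x ≤ 1 → x ≡ 0 ⊎ x ≡ 1
≤1⇒≡0⊎≡1 z≤n       = inj₁ refl
≤1⇒≡0⊎≡1 (s≤s z≤n) = inj₂ refl

-- The lowest part of a pure inverting composition is 0 or 1, and the two choices differ by a shift,
-- which changes purity.
order-determines-B : ∀ {β₁ β₂} m → All (0 <_) β₁ → All (0 <_) β₂ → Pure β₁ → Pure β₂ →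
                     Inverting β₁ → Inverting β₂ → length β₁ ≤ m → length β₂ ≤ m →
                     (∀ j → j < m → rankAt (nth β₂) m j ≡ rankAt (nth β₁) m j) → β₁ ≡ β₂
order-determines-B {β₁} {β₂} m β₁>0 β₂>0 pure₁ pure₂ inv₁ inv₂ ℓ₁≤m ℓ₂≤m same-rank =
  positive-nth-ext β₁>0 β₂>0 agree
  where
  f₁ = nth β₁
  f₂ = nth β₂
  invB₁ : InvertingBelow f₁ m
  invB₁ = Inverting⇒InvertingBelow β₁ m inv₁ ℓ₁≤m
  invB₂ : InvertingBelow f₂ m
  invB₂ = Inverting⇒InvertingBelow β₂ m inv₂ ℓ₂≤m
  agree-below : ∀ j → j < m → f₁ j ≡ f₂ j
  agree-below j j<m with lowest-exists f₁ m (≤-trans (s≤s z≤n) j<m)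
  ... | b , b<m , lowest₁ = by-lowest-values (≤1⇒≡0⊎≡1 (InvertingBelow⇒lowest≤1 f₁ m invB₁ b<m lowest₁))
                                             (≤1⇒≡0⊎≡1 (InvertingBelow⇒lowest≤1 f₂ m invB₂ b<m lowest₂))
    where
    lowest₂ : suc (rankAt f₂ m b) ≡ m
    lowest₂ = trans (cong suc (same-rank b b<m)) lowest₁
    offset : ∀ i → i < m → f₁ i + f₂ b ≡ f₂ i + f₁ b
    offset = offset-from-lowest f₁ f₂ m same-rank (InvertingBelow⇒adjacent f₁ m invB₁ (nth-ZerosLast β₁>0))
               (InvertingBelow⇒adjacent f₂ m invB₂ (nth-ZerosLast β₂>0)) b<m lowest₁
    same-lowest : f₁ b ≡ f₂ b → f₁ j ≡ f₂ j
    same-lowest f₁b≡f₂b = +-cancelʳ-≡ (f₂ b) (f₁ j) (f₂ j) (trans (offset j j<m) (cong (f₂ j +_) f₁b≡f₂b))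
    by-lowest-values : f₁ b ≡ 0 ⊎ f₁ b ≡ 1 → f₂ b ≡ 0 ⊎ f₂ b ≡ 1 → f₁ j ≡ f₂ j
    by-lowest-values (inj₁ f₁b≡0) (inj₁ f₂b≡0) = same-lowest (trans f₁b≡0 (sym f₂b≡0))
    by-lowest-values (inj₂ f₁b≡1) (inj₂ f₂b≡1) = same-lowest (trans f₁b≡1 (sym f₂b≡1))
    by-lowest-values (inj₂ f₁b≡1) (inj₁ f₂b≡0) = ⊥-elim (pure-not-shift-of-pure β₁>0 β₂>0 pure₁ pure₂ ℓ₁≤m
      (≤-<-trans (nth≡0⇒length≤ β₂>0 b f₂b≡0) b<m)
      (λ i i<m → trans (sym (+-identityʳ (f₁ i))) (trans (cong (f₁ i +_) (sym f₂b≡0))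
                   (trans (offset i i<m) (trans (cong (f₂ i +_) f₁b≡1) (+-comm (f₂ i) 1))))))
    by-lowest-values (inj₁ f₁b≡0) (inj₂ f₂b≡1) = ⊥-elim (pure-not-shift-of-pure β₂>0 β₁>0 pure₂ pure₁ ℓ₂≤m
      (≤-<-trans (nth≡0⇒length≤ β₁>0 b f₁b≡0) b<m)
      (λ i i<m → trans (sym (+-identityʳ (f₂ i))) (trans (cong (f₂ i +_) (sym f₁b≡0))
                   (trans (sym (offset i i<m)) (trans (cong (f₁ i +_) f₂b≡1) (+-comm (f₁ i) 1))))))
  agree : ∀ j → f₁ j ≡ f₂ j
  agree j with j <? m
  ... | yes j<m = agree-below j j<m
  ... | no  j≮m = let m≤j = ≮⇒≥ j≮m in
    trans (nth-beyond β₁ j (≤-trans ℓ₁≤m m≤j)) (sym (nth-beyond β₂ j (≤-trans ℓ₂≤m m≤j)))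

partition-determined : ∀ {λ₁ λ₂} f w → All (0 <_) λ₁ → All (0 <_) λ₂ → length λ₁ ≤ w → length λ₂ ≤ w →
                       (∀ j → j < w → φAt (nth λ₁) f w j ≡ φAt (nth λ₂) f w j) → λ₁ ≡ λ₂
partition-determined {λ₁} {λ₂} f w λ₁>0 λ₂>0 ℓ₁≤w ℓ₂≤w same-parts = positive-nth-ext λ₁>0 λ₂>0 agree
  where
  agree : ∀ r → nth λ₁ r ≡ nth λ₂ r
  agree r with r <? w
  ... | no  r≮w = let w≤r = ≮⇒≥ r≮w in
    trans (nth-beyond λ₁ r (≤-trans ℓ₁≤w w≤r)) (sym (nth-beyond λ₂ r (≤-trans ℓ₂≤w w≤r)))
  ... | yes r<w with rankAt-surjective f w r r<w
  ...   | j , j<w , rank≡r =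
    +-cancelˡ-≡ (f j) _ _ (subst (λ r′ → f j + nth λ₁ r′ ≡ f j + nth λ₂ r′) rank≡r (same-parts j j<w))

φ-injective : ∀ {n d} λ₁ β₁ λ₂ β₂ → InPB n d λ₁ β₁ → InPB n d λ₂ β₂ →
              φ λ₁ β₁ ≡ φ λ₂ β₂ → λ₁ ≡ λ₂ × β₁ ≡ β₂
φ-injective λ₁ β₁ λ₂ β₂ ((λ₁>0 , λ₁-dec) , _ , (β₁>0 , pure₁ , inv₁ , _) , _)
                        ((λ₂>0 , λ₂-dec) , _ , (β₂>0 , pure₂ , inv₂ , _) , _) φ₁≡φ₂
  with φ-≡-applyUpTo λ₁ β₁ _ (width λ₂ β₂) (trans φ₁≡φ₂ (φ-applyUpTo λ₂ β₂))
... | w₁≡w , φ-parts = λ₁≡λ₂ , β₁≡β₂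
  where
  w = width λ₂ β₂
  f₁ = nth β₁
  f₂ = nth β₂
  ℓ₁ = nth λ₁
  ℓ₂ = nth λ₂
  antitone₁ : Antitone ℓ₁
  antitone₁ = step⇒Antitone ℓ₁ (Decreasing⇒nth-step λ₁-dec)
  antitone₂ : Antitone ℓ₂
  antitone₂ = step⇒Antitone ℓ₂ (Decreasing⇒nth-step λ₂-dec)
  same-rank : ∀ j → j < w → rankAt f₂ w j ≡ rankAt f₁ w j
  same-rank j j<w = begin
    rankAt f₂ w j              ≡⟨ sym (rankAt-φAt ℓ₂ f₂ w antitone₂ j j<w) ⟩
    rankAt (φAt ℓ₂ f₂ w) w j   ≡⟨ rankAt-cong _ _ w (λ i i<w → sym (φ-parts i i<w)) j j<w ⟩
    rankAt (φAt ℓ₁ f₁ w) w j   ≡⟨ rankAt-φAt ℓ₁ f₁ w antitone₁ j j<w ⟩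
    rankAt f₁ w j              ∎
    where open ≡-Reasoning
  ℓβ₁≤w : length β₁ ≤ w
  ℓβ₁≤w = subst (length β₁ ≤_) w₁≡w (m≤m⊔n _ _)
  ℓλ₁≤w : length λ₁ ≤ w
  ℓλ₁≤w = subst (length λ₁ ≤_) w₁≡w (m≤n⊔m _ _)
  β₁≡β₂ : β₁ ≡ β₂
  β₁≡β₂ = order-determines-B w β₁>0 β₂>0 pure₁ pure₂ inv₁ inv₂ ℓβ₁≤w (m≤m⊔n _ _) same-rank
  λ₁≡λ₂ : λ₁ ≡ λ₂
  λ₁≡λ₂ = partition-determined f₂ w λ₁>0 λ₂>0 ℓλ₁≤w (m≤n⊔m _ _)
            (subst (λ β → ∀ j → j < w → φAt ℓ₁ (nth β) w j ≡ φAt ℓ₂ f₂ w j) β₁≡β₂ φ-parts)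

-- Removing a column

addColumn : ℕ → List ℕ → List ℕ
addColumn zero    xs       = xs
addColumn (suc h) []       = 1 ∷ addColumn h []
addColumn (suc h) (x ∷ xs) = suc x ∷ addColumn h xs

nth-addColumn : ∀ h xs r → nth (addColumn h xs) r ≡ nth xs r + fromBool (r <ᵇ h)
nth-addColumn zero    xs       r       = sym (+-identityʳ _)
nth-addColumn (suc h) []       zero    = refl
nth-addColumn (suc h) []       (suc r) = nth-addColumn h [] r
nth-addColumn (suc h) (x ∷ xs) zero    = +-comm 1 x
nth-addColumn (suc h) (x ∷ xs) (suc r) = nth-addColumn h xs r

length-addColumn : ∀ h xs → length (addColumn h xs) ≡ length xs ⊔ h
length-addColumn zero    xs       = sym (⊔-identityʳ _)
length-addColumn (suc h) []       = cong suc (length-addColumn h [])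
length-addColumn (suc h) (x ∷ xs) = cong suc (length-addColumn h xs)

addColumn-positive : ∀ h {xs} → All (0 <_) xs → All (0 <_) (addColumn h xs)
addColumn-positive zero    xs>0       = xs>0
addColumn-positive (suc h) []         = z<s ∷ addColumn-positive h []
addColumn-positive (suc h) (_ ∷ xs>0) = z<s ∷ addColumn-positive h xs>0

addColumn-Decreasing : ∀ h {xs} → Decreasing xs → Decreasing (addColumn h xs)
addColumn-Decreasing h {xs} dec = nth-step⇒Decreasing _ λ r →
  subst₂ _≤_ (sym (nth-addColumn h xs (suc r))) (sym (nth-addColumn h xs r))
    (+-mono-≤ (Decreasing⇒nth-step dec r) (column-step r h))
  where
  column-step : ∀ r h → fromBool (suc r <ᵇ h) ≤ fromBool (r <ᵇ h)
  column-step r       zero    = z≤n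
  column-step zero    (suc h) = fromBool-mono (λ _ → _)
  column-step (suc r) (suc h) = column-step r h

inTop : (ℕ → ℕ) → ℕ → ℕ → ℕ → ℕ
inTop f m h p = fromBool (rankAt f m p <ᵇ h)

removeColumn : (ℕ → ℕ) → ℕ → ℕ → ℕ → ℕ
removeColumn f m h p = f p ∸ inTop f m h p

module _ (f : ℕ → ℕ) (m h : ℕ) where

  inTop-view : ∀ p → (rankAt f m p < h × inTop f m h p ≡ 1) ⊎ (h ≤ rankAt f m p × inTop f m h p ≡ 0)
  inTop-view p with rankAt f m p <ᵇ h | <ᵇ-reflects-< (rankAt f m p) h
  ... | true  | ofʸ top  = inj₁ (top , refl)
  ... | false | ofⁿ ¬top = inj₂ (≮⇒≥ ¬top , refl)

  removeColumn-top : ∀ {p} → rankAt f m p < h → removeColumn f m h p ≡ f p ∸ 1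
  removeColumn-top {p} top with inTop-view p
  ... | inj₁ (_ , in≡1)    = cong (f p ∸_) in≡1
  ... | inj₂ (bottom , _) = ⊥-elim (<⇒≱ top bottom)

  removeColumn-bottom : ∀ {p} → h ≤ rankAt f m p → removeColumn f m h p ≡ f p
  removeColumn-bottom {p} bottom with inTop-view p
  ... | inj₁ (top , _)  = ⊥-elim (<⇒≱ top bottom)
  ... | inj₂ (_ , in≡0) = cong (f p ∸_) in≡0

  TopAtLeast2 : Set
  TopAtLeast2 = ∀ p → p < m → rankAt f m p < h → 2 ≤ f p

  TopStaysAbove : Set
  TopStaysAbove = ∀ p q → p < m → q < m → rankAt f m p < h → h ≤ rankAt f m q → Above (removeColumn f m h) p q

  module _ (top≥2 : TopAtLeast2) (top-above : TopStaysAbove) where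

    removeColumn-preserves-Above : ∀ p q → p < m → q < m → Above f p q → Above (removeColumn f m h) p q
    removeColumn-preserves-Above p q p<m q<m p>q with rankAt f m p <? h | rankAt f m q <? h
    ... | yes p-top | yes q-top rewrite removeColumn-top p-top | removeColumn-top q-top = minus-one p>q
      where
      minus-one : Above f p q → Above (λ i → f i ∸ 1) p q
      minus-one (inj₁ fq<fp)          = inj₁ (∸-monoˡ-< fq<fp (≤-trans (s≤s z≤n) (top≥2 q q<m q-top)))
      minus-one (inj₂ (fq≡fp , q<p)) = inj₂ (cong (_∸ 1) fq≡fp , q<p)
    ... | yes p-top | no  q≮h   = top-above p q p<m q<m p-top (≮⇒≥ q≮h)
    ... | no  p≮h   | yes q-top = ⊥-elim (<-asym (Above⇒rankAt-< f m p q p<m p>q) (<-≤-trans q-top (≮⇒≥ p≮h)))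
    ... | no  p≮h   | no  q≮h   =
      subst₂ (λ a b → b < a ⊎ (b ≡ a × q < p))
             (sym (removeColumn-bottom (≮⇒≥ p≮h))) (sym (removeColumn-bottom (≮⇒≥ q≮h))) p>q

    rankAt-removeColumn : ∀ j → j < m → rankAt (removeColumn f m h) m j ≡ rankAt f m j
    rankAt-removeColumn = rankAt-preserved f (removeColumn f m h) m removeColumn-preserves-Above

    removeColumn+inTop : ∀ p → p < m → removeColumn f m h p + inTop f m h p ≡ f p
    removeColumn+inTop p p<m with inTop-view p
    ... | inj₁ (top , in≡1) = trans (cong (λ c → f p ∸ c + c) in≡1) (m∸n+n≡m (≤-trans (s≤s z≤n) (top≥2 p p<m top)))
    ... | inj₂ (_ , in≡0)   = trans (cong (λ c → f p ∸ c + c) in≡0) (+-identityʳ (f p))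

Preimage : List ℕ → Set
Preimage α = ∃[ λ' ] ∃[ β ] (IsPartition λ' × length λ' ≤ length α × InB (length α) β × φ λ' β ≡ α)

module _ (α : List ℕ) (h : ℕ) (h≤m : h ≤ length α) (top≥2 : TopAtLeast2 (nth α) (length α) h) where

  private
    m = length α
    f = nth α
    g = removeColumn f m h

  removeColumn-positive : All (0 <_) α → All (0 <_) (applyUpTo g m)
  removeColumn-positive α>0 = applyUpTo⁺₁ g m λ {p} p<m → positive p p<m
    where
    positive : ∀ p → p < m → 0 < g p
    positive p p<m with rankAt f m p <? h
    ... | yes top = subst (0 <_) (sym (removeColumn-top f m h top)) (∸-monoˡ-< (top≥2 p p<m top) (s≤s z≤n))
    ... | no  p≮h = subst (0 <_) (sym (removeColumn-bottom f m h (≮⇒≥ p≮h))) (nth-positive α>0 p p<m)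

  sum-removeColumn : 0 < h → sum (applyUpTo g m) < sum α
  sum-removeColumn h>0 with rankAt-surjective f m 0 (<-≤-trans h>0 h≤m)
  ... | p , p<m , rank≡0 = begin-strict
    sum (applyUpTo g m) ≡⟨ sum-applyUpTo g m ⟩
    sumBelow g m        <⟨ sumBelow-mono-< g f m (λ i _ → m∸n≤m (f i) (inTop f m h i)) p p<m gp<fp ⟩
    sumBelow f m        ≡⟨ sym (sum-sumBelow α m ≤-refl) ⟩
    sum α               ∎
    where
    open ≤-Reasoning
    top : rankAt f m p < h
    top = subst (_< h) (sym rank≡0) h>0
    gp<fp : g p < f p
    gp<fp = subst (_< f p) (sym (removeColumn-top f m h top)) (∸-monoʳ-< {o = 0} z<s (≤-trans (s≤s z≤n) (top≥2 p p<m top)))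

  φ-addColumn : TopStaysAbove f m h → ∀ {λ' β} → Decreasing λ' → φ λ' β ≡ applyUpTo g m → φ (addColumn h λ') β ≡ α
  φ-addColumn top-above {λ'} {β} λ'-dec φ≡ = begin
    φ (addColumn h λ') β                           ≡⟨ φ-applyUpTo (addColumn h λ') β ⟩
    applyUpTo (φAt (nth (addColumn h λ')) f' w) w  ≡⟨ cong (λ w → applyUpTo (φAt (nth (addColumn h λ')) f' w) w) width≡m ⟩
    applyUpTo (φAt (nth (addColumn h λ')) f' m) m  ≡⟨ applyUpTo-cong _ _ m part ⟩
    applyUpTo f m                                  ≡⟨ applyUpTo-nth α ⟩
    α                                              ∎
    where
    open ≡-Reasoning
    ℓ' = nth λ'
    f' = nth β
    w = width (addColumn h λ') β
    parts : width λ' β ≡ m × (∀ p → p < m → φAt ℓ' f' m p ≡ g p)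
    parts = φ-≡-applyUpTo λ' β g m φ≡
    width≡m : w ≡ m
    width≡m = begin
      length β ⊔ length (addColumn h λ')   ≡⟨ cong (length β ⊔_) (length-addColumn h λ') ⟩
      length β ⊔ (length λ' ⊔ h)           ≡⟨ sym (⊔-assoc (length β) (length λ') h) ⟩
      width λ' β ⊔ h                       ≡⟨ cong (_⊔ h) (proj₁ parts) ⟩
      m ⊔ h                                ≡⟨ m≥n⇒m⊔n≡m h≤m ⟩
      m                                    ∎
    same-rank : ∀ p → p < m → rankAt f' m p ≡ rankAt f m p
    same-rank p p<m = begin
      rankAt f' m p              ≡⟨ sym (rankAt-φAt ℓ' f' m (step⇒Antitone ℓ' (Decreasing⇒nth-step λ'-dec)) p p<m) ⟩
      rankAt (φAt ℓ' f' m) m p   ≡⟨ rankAt-cong _ _ m (proj₂ parts) p p<m ⟩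
      rankAt g m p               ≡⟨ rankAt-removeColumn f m h top≥2 top-above p p<m ⟩
      rankAt f m p               ∎
    part : ∀ p → p < m → φAt (nth (addColumn h λ')) f' m p ≡ f p
    part p p<m = begin
      f' p + nth (addColumn h λ') (rankAt f' m p)
        ≡⟨ cong (f' p +_) (nth-addColumn h λ' _) ⟩
      f' p + (ℓ' (rankAt f' m p) + fromBool (rankAt f' m p <ᵇ h))
        ≡⟨ sym (+-assoc (f' p) _ _) ⟩
      φAt ℓ' f' m p + fromBool (rankAt f' m p <ᵇ h)
        ≡⟨ cong₂ (λ a r → a + fromBool (r <ᵇ h)) (proj₂ parts p p<m) (same-rank p p<m) ⟩
      g p + inTop f m h p
        ≡⟨ removeColumn+inTop f m h top≥2 top-above p p<m ⟩
      f p ∎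

  Preimage-addColumn : TopStaysAbove f m h → Preimage (applyUpTo g m) → Preimage α
  Preimage-addColumn top-above (λ' , β , (λ'>0 , λ'-dec) , ℓλ'≤ , (β>0 , pure , inv , ℓβ≤) , φ≡) =
    addColumn h λ' , β , (addColumn-positive h λ'>0 , addColumn-Decreasing h λ'-dec) ,
    subst (_≤ m) (sym (length-addColumn h λ')) (⊔-lub (subst (length λ' ≤_) ℓg≡m ℓλ'≤) h≤m) ,
    (β>0 , pure , inv , subst (length β ≤_) ℓg≡m ℓβ≤) , φ-addColumn top-above {λ'} {β} λ'-dec φ≡
    where
    ℓg≡m : length (applyUpTo g m) ≡ m
    ℓg≡m = length-applyUpTo g m

-- Surjectivity

InvertingBelow-shift⁻ : ∀ {β} j → All (0 <_) β →
                        InvertingBelow (nth (shift β j)) (length β + j) → InvertingBelow (nth β) (length β)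
InvertingBelow-shift⁻ {β} j β>0 inverting i i>1 (p , p<ℓ , i≤βp)
  with inverting (suc i) (m<n⇒m<1+n i>1)
         (p , p<ℓ+j , subst (suc i ≤_) (sym (nth-shift β j p p<ℓ+j)) (s≤s i≤βp))
  where
  p<ℓ+j : p < length β + j
  p<ℓ+j = <-≤-trans p<ℓ (m≤m+n _ j)
... | s , t , s<t , t<ℓ+j , shift-s≡1+i , shift-t≡i = s , t , s<t , t<ℓ , βs≡i , βt≡i-1
  where
  βt+1≡i : suc (nth β t) ≡ i
  βt+1≡i = trans (sym (nth-shift β j t t<ℓ+j)) shift-t≡i
  t<ℓ : t < length β
  t<ℓ with t <? length β
  ... | yes t<ℓ = t<ℓ
  ... | no  t≮ℓ = ⊥-elim (<-irrefl (trans (cong suc (sym (nth-beyond β t (≮⇒≥ t≮ℓ)))) βt+1≡i) i>1)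
  βs≡i : nth β s ≡ i
  βs≡i = suc-injective (trans (sym (nth-shift β j s (<-trans s<t t<ℓ+j))) shift-s≡1+i)
  βt≡i-1 : nth β t ≡ pred i
  βt≡i-1 = cong pred βt+1≡i

Inverting-shift⁻ : ∀ {β} j → All (0 <_) β → Inverting (shift β j) → Inverting β
Inverting-shift⁻ {β} j β>0 inverting = InvertingBelow⇒Inverting β (InvertingBelow-shift⁻ j β>0
  (Inverting⇒InvertingBelow (shift β j) (length β + j) inverting (≤-reflexive (length-shift β j))))

φ-[] : ∀ α → φ [] α ≡ α
φ-[] α = begin
  φ [] α                                ≡⟨ φ-applyUpTo [] α ⟩
  applyUpTo (φAt (nth []) (nth α) w) w  ≡⟨ cong (λ w → applyUpTo (φAt (nth []) (nth α) w) w) (⊔-identityʳ ℓ) ⟩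
  applyUpTo (φAt (nth []) (nth α) ℓ) ℓ  ≡⟨ applyUpTo-cong _ _ ℓ (λ p _ → +-identityʳ (nth α p)) ⟩
  applyUpTo (nth α) ℓ                   ≡⟨ applyUpTo-nth α ⟩
  α                                     ∎
  where
  open ≡-Reasoning
  w = width [] α
  ℓ = length α

φ-ones : ∀ β j → φ (replicate (length β + j) 1) β ≡ shift β j
φ-ones β j = begin
  φ ones β                                     ≡⟨ φ-applyUpTo ones β ⟩
  applyUpTo (φAt (nth ones) (nth β) w) w       ≡⟨ cong (λ w → applyUpTo (φAt (nth ones) (nth β) w) w) w≡ℓ ⟩
  applyUpTo (φAt (nth ones) (nth β) ℓ) ℓ       ≡⟨ applyUpTo-cong _ _ ℓ part ⟩
  applyUpTo (nth (shift β j)) ℓ                ≡⟨ cong (applyUpTo (nth (shift β j))) (sym (length-shift β j)) ⟩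
  applyUpTo (nth (shift β j)) (length (shift β j)) ≡⟨ applyUpTo-nth (shift β j) ⟩
  shift β j                                    ∎
  where
  open ≡-Reasoning
  ℓ = length β + j
  ones = replicate ℓ 1
  w = width ones β
  w≡ℓ : w ≡ ℓ
  w≡ℓ = trans (cong (length β ⊔_) (length-replicate ℓ)) (m≤n⇒m⊔n≡n (m≤m+n (length β) j))
  part : ∀ p → p < ℓ → φAt (nth ones) (nth β) ℓ p ≡ nth (shift β j) p
  part p p<ℓ = trans (cong (nth β p +_) (nth-replicate ℓ 1 _ (rankAt<m (nth β) ℓ p p<ℓ)))
                     (trans (+-comm (nth β p) 1) (sym (nth-shift β j p p<ℓ)))

replicate-Decreasing : ∀ n x → Decreasing (replicate n x)
replicate-Decreasing zero          x = dec[]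
replicate-Decreasing (suc zero)    x = dec[ x ]
replicate-Decreasing (suc (suc n)) x = dec∷ ≤-refl (replicate-Decreasing (suc n) x)

even-or-odd : ∀ n → Even n ⊎ ∃[ n′ ] (n ≡ suc n′ × Even n′)
even-or-odd zero    = inj₁ even-zero
even-or-odd (suc n) with even-or-odd n
... | inj₁ ev               = inj₂ (n , refl , ev)
... | inj₂ (n′ , refl , ev) = inj₁ (even-ss ev)

-- An impure inverting composition is shift β j for a pure β, and then φ 1^{length α} β = α.
Inverting⇒Preimage : ∀ α → All (0 <_) α → Inverting α → Preimage α
Inverting⇒Preimage α α>0 inverting with MaxTail-exists α α>0
... | K , tail , maximal with even-or-odd K
...   | inj₁ ev = [] , α , ([] , dec[]) , z≤n , (α>0 , (K , tail , maximal , ev) , inverting , ≤-refl) , φ-[] α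
...   | inj₂ (K′ , refl , ev) with HasTail⇒Shifted tail
...     | β , j , j>0 , β>0 , refl =
  replicate ℓ 1 , β , (replicate⁺ ℓ z<s , replicate-Decreasing ℓ 1) , ℓ-ones≤ ,
  (β>0 , (K′ , proj₁ β-max , proj₂ β-max , ev) , Inverting-shift⁻ j β>0 inverting ,
   subst (length β ≤_) (sym (length-shift β j)) (m≤m+n _ j)) ,
  φ-ones β j
  where
  ℓ = length β + j
  β-max : MaxTail β K′
  β-max = MaxTail-shift⁻ β>0 j>0 (tail , maximal)
  ℓ-ones≤ : length (replicate ℓ 1) ≤ length (shift β j)
  ℓ-ones≤ = ≤-reflexive (trans (length-replicate ℓ) (sym (length-shift β j)))

module _ (f : ℕ → ℕ) (m : ℕ) where

  AdjacentViolation : Set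
  AdjacentViolation = ∃[ j ] ∃[ k ] (j < m × k < m × Adjacent f m j k × f k + ε j k < f j)

  LowestViolation : Set
  LowestViolation = ∃[ b ] (b < m × suc (rankAt f m b) ≡ m × 1 < f b)

  adjacent-ok? : ∀ j k → Dec (Adjacent f m j k → f j ≤ f k + ε j k)
  adjacent-ok? j k = (rankAt f m k ≟ suc (rankAt f m j)) →-dec (f j ≤? f k + ε j k)

  adjacent-tight-or-violated : AdjacentTight f m ⊎ AdjacentViolation
  adjacent-tight-or-violated with all-or-counterexample (λ j → all<? (adjacent-ok? j) m) m
  ... | inj₁ all = inj₁ λ j k j<m k<m → all j j<m k k<m
  ... | inj₂ (j , j<m , ¬all) with all-or-counterexample (adjacent-ok? j) m
  ...   | inj₁ all                = ⊥-elim (¬all all)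
  ...   | inj₂ (k , k<m , ¬ok) with counterexample-→ (rankAt f m k ≟ suc (rankAt f m j)) (f j ≤? f k + ε j k) ¬ok
  ...     | adjacent , ≰ = inj₂ (j , k , j<m , k<m , adjacent , ≰⇒> ≰)

  lowest-tight-or-violated : LowestTight f m ⊎ LowestViolation
  lowest-tight-or-violated with all-or-counterexample (λ b → (suc (rankAt f m b) ≟ m) →-dec (f b ≤? 1)) m
  ... | inj₁ all = inj₁ all
  ... | inj₂ (b , b<m , ¬ok) with counterexample-→ (suc (rankAt f m b) ≟ m) (f b ≤? 1) ¬ok
  ...   | lowest , ≰ = inj₂ (b , b<m , lowest , ≰⇒> ≰)

  ColumnRemovable : ℕ → Set
  ColumnRemovable h = h ≤ m × 0 < h × TopAtLeast2 f m h × TopStaysAbove f m h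

  lowest-violation⇒removable : LowestViolation → ∃[ h ] ColumnRemovable h
  lowest-violation⇒removable (b , b<m , lowest , fb>1) =
    m , ≤-refl , ≤-trans (s≤s z≤n) b<m , (λ p p<m _ → ≤-trans fb>1 (lowest-minimal f m b<m lowest p p<m)) ,
    λ p q p<m q<m _ m≤rq → ⊥-elim (<⇒≱ (rankAt<m f m q q<m) m≤rq)

  -- Subtracting one from the parts ranked at or above j keeps them above the rest: a tie would force
  -- f j - 1 = f k + ε j k with ε j k = 0, whence the tied parts are ordered by position as required.
  adjacent-violation⇒TopStaysAbove : ∀ {j k} → j < m → k < m → Adjacent f m j k → f k + ε j k < f j →
                                     TopAtLeast2 f m (suc (rankAt f m j)) → TopStaysAbove f m (suc (rankAt f m j))
  adjacent-violation⇒TopStaysAbove {j} {k} j<m k<m adjacent violation top≥2 p q p<m q<m p-top q-bottom =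
    subst₂ (λ a b → b < a ⊎ (b ≡ a × q < p)) (sym (removeColumn-top f m h p-top)) (sym (removeColumn-bottom f m h q-bottom)) above
    where
    h = suc (rankAt f m j)
    q-below-k : f q ≤ f k × (f q ≡ f k → q ≤ k)
    q-below-k = rankAt-≤⇒parts-≥ f m k<m q<m (subst (_≤ rankAt f m q) (sym adjacent) q-bottom)
    p-above-j : f j ≤ f p × (f j ≡ f p → j ≤ p)
    p-above-j = rankAt-≤⇒parts-≥ f m p<m j<m (s≤s⁻¹ p-top)
    fk+ε≤fj-1 : f k + ε j k ≤ f j ∸ 1
    fk+ε≤fj-1 = ∸-monoˡ-≤ 1 violation
    fj-1≤fp-1 : f j ∸ 1 ≤ f p ∸ 1
    fj-1≤fp-1 = ∸-monoˡ-≤ 1 (proj₁ p-above-j)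
    fq≤fp-1 : f q ≤ f p ∸ 1
    fq≤fp-1 = ≤-trans (proj₁ q-below-k) (≤-trans (m≤m+n _ _) (≤-trans fk+ε≤fj-1 fj-1≤fp-1))
    above : f q < f p ∸ 1 ⊎ (f q ≡ f p ∸ 1 × q < p)
    above with m≤n⇒m<n∨m≡n fq≤fp-1
    ... | inj₁ fq<fp-1 = inj₁ fq<fp-1
    ... | inj₂ fq≡fp-1 = inj₂ (fq≡fp-1 , ≤-<-trans q≤k (<-≤-trans k<j j≤p))
      where
      fk+ε≤fq : f k + ε j k ≤ f q
      fk+ε≤fq = ≤-trans fk+ε≤fj-1 (≤-trans fj-1≤fp-1 (≤-reflexive (sym fq≡fp-1)))
      fq≡fk : f q ≡ f k
      fq≡fk = ≤-antisym (proj₁ q-below-k) (≤-trans (m≤m+n _ _) fk+ε≤fq)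
      q≤k : q ≤ k
      q≤k = proj₂ q-below-k fq≡fk
      k<j : k < j
      k<j with ε-view j k
      ... | inj₁ (_ , ε≡1)  = ⊥-elim (<-irrefl refl (subst (_≤ f k) (trans (cong (f k +_) ε≡1) (+-comm (f k) 1))
                                                      (≤-trans fk+ε≤fq (≤-reflexive fq≡fk))))
      ... | inj₂ (k≤j , _) = ≤∧≢⇒< k≤j (λ { refl → <-irrefl adjacent ≤-refl })
      fj-1≡fp-1 : f j ∸ 1 ≡ f p ∸ 1
      fj-1≡fp-1 = ≤-antisym fj-1≤fp-1
                    (≤-trans (≤-reflexive (trans (sym fq≡fp-1) fq≡fk)) (≤-trans (m≤m+n _ _) fk+ε≤fj-1))
      j≤p : j ≤ p
      j≤p = proj₂ p-above-j (trans (sym (m∸n+n≡m (≤-trans (s≤s z≤n) (top≥2 j j<m ≤-refl))))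
                            (trans (cong (_+ 1) fj-1≡fp-1) (m∸n+n≡m (≤-trans (s≤s z≤n) (top≥2 p p<m p-top)))))

  adjacent-violation⇒removable : (∀ i → i < m → 0 < f i) → AdjacentViolation → ∃[ h ] ColumnRemovable h
  adjacent-violation⇒removable positive (j , k , j<m , k<m , adjacent , violation) =
    suc (rankAt f m j) , rankAt<m f m j j<m , z<s , top≥2 , adjacent-violation⇒TopStaysAbove j<m k<m adjacent violation top≥2
    where
    fj≥2 : 2 ≤ f j
    fj≥2 = ≤-trans (s≤s (≤-trans (positive k k<m) (m≤m+n (f k) (ε j k)))) violation
    top≥2 : TopAtLeast2 f m (suc (rankAt f m j))
    top≥2 p p<m p-top = ≤-trans fj≥2 (proj₁ (rankAt-≤⇒parts-≥ f m p<m j<m (s≤s⁻¹ p-top)))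

inverting-or-removable : ∀ α → All (0 <_) α → Inverting α ⊎ ∃[ h ] ColumnRemovable (nth α) (length α) h
inverting-or-removable α α>0 with adjacent-tight-or-violated (nth α) (length α) | lowest-tight-or-violated (nth α) (length α)
... | inj₂ violation | _              = inj₂ (adjacent-violation⇒removable (nth α) (length α) (nth-positive α>0) violation)
... | inj₁ _         | inj₂ violation = inj₂ (lowest-violation⇒removable (nth α) (length α) violation)
... | inj₁ adjacent  | inj₁ lowest    =
  inj₁ (InvertingBelow⇒Inverting α (tight⇒InvertingBelow (nth α) (length α) adjacent lowest))

Preimage-exists : ∀ α → All (0 <_) α → Preimage α
Preimage-exists α = go (suc (sum α)) α ≤-refl
  where
  go : ∀ s α → sum α < s → All (0 <_) α → Preimage α
  go (suc s) α |α|<1+s α>0 with inverting-or-removable α α>0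
  ... | inj₁ inverting = Inverting⇒Preimage α α>0 inverting
  ... | inj₂ (h , h≤m , h>0 , top≥2 , top-above) =
    Preimage-addColumn α h h≤m top≥2 top-above
      (go s _ (<-≤-trans (sum-removeColumn α h h≤m top≥2 h>0) (s≤s⁻¹ |α|<1+s)) (removeColumn-positive α h h≤m top≥2 α>0))

φ-surjective : ∀ n d α → InC n d α → ∃[ λ' ] ∃[ β ] (InPB n d λ' β × φ λ' β ≡ α)
φ-surjective n d α (α>0 , |α|≡d , ℓα≤n) with Preimage-exists α α>0
... | λ' , β , partition , ℓλ'≤ , (β>0 , pure , inv , ℓβ≤) , φ≡α =
  λ' , β , (partition , ≤-trans ℓλ'≤ ℓα≤n , (β>0 , pure , inv , ≤-trans ℓβ≤ ℓα≤n) ,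
            trans (sym (sum-φ λ' β)) (trans (cong sum φ≡α) |α|≡d)) , φ≡α

proposition3p2 : ∀ (n d : ℕ) → 1 ≤ n →
    (∀ λ' β → InPB n d λ' β → InC n d (φ λ' β))
    × (∀ λ₁ β₁ λ₂ β₂ → InPB n d λ₁ β₁ → InPB n d λ₂ β₂ →
    φ λ₁ β₁ ≡ φ λ₂ β₂ → λ₁ ≡ λ₂ × β₁ ≡ β₂)
    × (∀ α → InC n d α → ∃[ λ' ] ∃[ β ] (InPB n d λ' β × φ λ' β ≡ α))
proposition3p2 n d _ = φ-InC n d , φ-injective , φ-surjective n d
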